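{- For integers $n\geq0$ and $p\geq 1$, \[ \sum_{m_p\geq \dots\geq m_{1}\geq 0} \frac{q^{m_p^2+m_{p-1}^2 +\dots+m_1^2}(q;q)_{2n}}{(q;q)_{n-m_p}(q;q)_{m_p - m_{p-1}}\cdots (q;q)_{m_2-m_1}(q;q)_{2m_1}} = \sum_{r=-\infty}^{\infty} (-1)^r q^{\frac{r( 3r +1)}{2}+p\left(\frac{3r}{2} - \frac{(-1)^r-1}{4}\right)^2} {2n\brack n - \frac{3r}{2} + \frac{(-1)^r-1}{4}}_q. \]
   Context: $(a;q)_m=\prod_{j=0}^{m-1}(1-aq^j)$ for $m\ge0$, and $1/(q;q)_m:=0$ for $m<0$ (so only $m_p\le n$ contribute). The left sum is over integers $m_p\ge\dots\ge m_1\ge0$; when $p=1$ the denominator is $(q;q)_{n-m_1}(q;q)_{2m_1}$. For integers $a,b$, ${a\brack b}_q=\frac{(q;q)_a}{(q;q)_b(q;q)_{a-b}}$ if $0\le b\le a$ and $0$ otherwise. -}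

module Defs where

open import Data.Nat as ℕ using (ℕ; zero; suc)
open import Data.Integer as ℤ using (ℤ; +_; -[1+_]; ∣_∣)
open import Data.Rational as ℚ using (ℚ; 0ℚ; 1ℚ)
open import Data.Rational.Properties using () renaming (_≟_ to _≟ℚ_)
open import Data.List using (List; []; _∷_; map; concatMap; foldr; upTo)
open import Data.Vec using (Vec; []; _∷_)
open import Data.Bool using (if_then_else_)
open import Relation.Nullary using (yes; no)
open import Relation.Nullary.Decidable using (⌊_⌋)
open import Data.Product using (_×_)

-- Total inverse on ℚ: 1/x for x ≠ 0, and 0 at 0 (only used at nonzero arguments
-- under the hypotheses of the theorem).
inv : ℚ → ℚ
inv x with x ≟ℚ 0ℚ
... | yes _ = 0ℚ
... | no x≢0 = ℚ.1/_ x {{ℚ.≢-nonZero x≢0}}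

_÷_ : ℚ → ℚ → ℚ
x ÷ y = x ℚ.* inv y

_^_ : ℚ → ℕ → ℚ
x ^ zero  = 1ℚ
x ^ suc k = x ℚ.* (x ^ k)

_^ℤ_ : ℚ → ℤ → ℚ
x ^ℤ (+ k)      = x ^ k
x ^ℤ -[1+ k ]   = inv (x ^ suc k)

Σℚ : List ℚ → ℚ
Σℚ = foldr ℚ._+_ 0ℚ

poch : ℚ → ℚ → ℕ → ℚ
poch a q zero    = 1ℚ
poch a q (suc m) = poch a q m ℚ.* (1ℚ ℚ.- a ℚ.* (q ^ m))

qq : ℚ → ℕ → ℚ
qq q m = poch q q m

qbinom : ℚ → ℤ → ℤ → ℚ
qbinom q a b =
  if ⌊ ℤ.0ℤ ℤ.≤? b ⌋ Data.Bool.∧ ⌊ b ℤ.≤? a ⌋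
  then qq q ∣ a ∣ ÷ (qq q ∣ b ∣ ℚ.* qq q ∣ a ℤ.- b ∣)
  else 0ℚ

-- All sequences (m_p, m_{p-1}, ..., m_1) (listed from m_p down to m_1) with
-- u ≥ m_p ≥ m_{p-1} ≥ ... ≥ m_1 ≥ 0.
chains : (p u : ℕ) → List (Vec ℕ p)
chains zero    u = [] ∷ []
chains (suc p) u = concatMap (λ m → map (m ∷_) (chains p m)) (upTo (suc u))

sqsum : {p : ℕ} → Vec ℕ p → ℕ
sqsum []      = 0
sqsum (m ∷ v) = m ℕ.* m ℕ.+ sqsum v

-- denom q u (m_p, ..., m_1)
--   = (q;q)_{u-m_p} (q;q)_{m_p-m_{p-1}} ... (q;q)_{m_2-m_1} (q;q)_{2 m_1}
-- (all differences are nonnegative on chains)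
denom : ℚ → {p : ℕ} → ℕ → Vec ℕ p → ℚ
denom q u []      = qq q (2 ℕ.* u)
denom q u (m ∷ v) = qq q (u ℕ.∸ m) ℚ.* denom q m v

-- Left-hand side. Terms with m_p > n vanish since 1/(q;q)_{n-m_p} = 0 then,
-- so the sum ranges over chains with n ≥ m_p ≥ ... ≥ m_1 ≥ 0.
lhs : ℚ → (n p : ℕ) → ℚ
lhs q n p =
  Σℚ (map (λ v → ((q ^ sqsum v) ℚ.* qq q (2 ℕ.* n)) ÷ denom q n v) (chains p n))

sgnpow : ℤ → ℤ
sgnpow r = ℤ.-1ℤ ℤ.^ ∣ r ∣

-- 3r/2 - ((-1)^r - 1)/4 = (6r + 1 - (-1)^r)/4   (an integer)
kk : ℤ → ℤ
kk r = (ℤ.+ 6 ℤ.* r ℤ.+ ℤ.1ℤ ℤ.- sgnpow r) ℤ./ℕ 4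

pent : ℤ → ℤ
pent r = (r ℤ.* (ℤ.+ 3 ℤ.* r ℤ.+ ℤ.1ℤ)) ℤ./ℕ 2

rhsTerm : ℚ → (n p : ℕ) → ℤ → ℚ
rhsTerm q n p r =
  (ℚ._/_ (sgnpow r) 1 ℚ.* (q ^ℤ (pent r ℤ.+ (+ p) ℤ.* (kk r ℤ.* kk r))))
    ℚ.* qbinom q (+ (2 ℕ.* n)) ((+ n) ℤ.- kk r)

symSum : (ℤ → ℚ) → ℕ → ℚ
symSum f zero    = f ℤ.0ℤ
symSum f (suc M) = symSum f M ℚ.+ f (+ suc M) ℚ.+ f (ℤ.- (+ suc M))

{-# OPTIONS --safe #-}
module Submission where

-- Write [m] = 1/(q;q)_m, with [m] = 0 for m < 0; since q ≠ ±1 is not a root of unity, (q;q)_m ≠ 0.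
-- Divided by (q;q)_{2n}, the right-hand side is Σ_r c_p(r) [n - k_r] [n + k_r] with
-- c_p(r) = (-1)^r q^(r(3r+1)/2 + p k_r²), and the left-hand side arises from [2n] by p applications of
-- β ↦ (n ↦ Σ_m q^(m²) [n - m] β_m). The Bailey-lemma evaluation
-- Σ_m q^(m²) [n - m] [m - k] [m + k] = q^(k²) [n - k] [n + k] shows that the same map takes the right-hand
-- side for p to the one for p + 1, so only p = 0 remains: Σ_r (-1)^r q^(r(3r+1)/2) [n - k_r] [n + k_r] = [2n].
-- Pairing r = 2s with r = 2s + 1, this follows by induction on n from the q-Pascal rule
-- (1 - q^(a+b)) [a] [b] = [a - 1] [b] + q^a [a] [b - 1], which passes from n to n + 1 up to a telescoping sum.

open import Defs
open import Function using (_∘_)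
open import Level using (0ℓ)
open import Data.Nat as ℕ using (ℕ; zero; suc; _∸_; _≤_; _<_; z≤n; s≤s)
import Data.Nat.Properties as ℕP
import Data.Nat.DivMod as ℕD
import Data.Nat.Tactic.RingSolver as ℕ-Solver
open import Data.Integer as ℤ using (ℤ; +_; -[1+_]; 1ℤ; -1ℤ; _/ℕ_)
import Data.Integer.Properties as ℤP
import Data.Integer.DivMod as ℤD
import Data.Integer.Tactic.RingSolver as ℤ-Solver
open import Data.Rational as ℚ using (ℚ; 0ℚ; 1ℚ; _+_; _*_; _-_; -_)
import Data.Rational.Properties as ℚP
open import Data.List using (List; []; _∷_; map; concatMap; upTo; applyUpTo; _++_)
import Data.List.Properties as ListP
open import Data.Vec using (Vec; _∷_)
open import Data.Maybe using (Maybe; just; nothing)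
open import Data.Product using (∃; ∃-syntax; _,_)
open import Data.Sum using (_⊎_; inj₁; inj₂)
open import Relation.Nullary using (Dec; yes; no; contradiction)
open import Relation.Binary.Definitions using (tri<; tri≈; tri>)
open import Relation.Binary.PropositionalEquality
open import Tactic.RingSolver using (solve-∀)
open import Tactic.RingSolver.Core.AlmostCommutativeRing using (AlmostCommutativeRing; fromCommutativeRing)

ℚ-ring : AlmostCommutativeRing 0ℓ 0ℓ
ℚ-ring = fromCommutativeRing ℚP.+-*-commutativeRing isZero
  where
  isZero : ∀ x → Maybe (0ℚ ≡ x)
  isZero x with x ℚP.≟ 0ℚ
  ... | yes x≡0 = just (sym x≡0)
  ... | no _    = nothing

inv-inverseʳ : ∀ {x} → x ≢ 0ℚ → x * inv x ≡ 1ℚ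
inv-inverseʳ {x} x≢0 with x ℚP.≟ 0ℚ
... | yes x≡0 = contradiction x≡0 x≢0
... | no x≢0′ = ℚP.*-inverseʳ x {{ℚ.≢-nonZero x≢0′}}

*-cancelˡ-≢0 : ∀ {c} a b → c ≢ 0ℚ → c * a ≡ c * b → a ≡ b
*-cancelˡ-≢0 {c} a b c≢0 ca≡cb = begin
  a                  ≡⟨ unit a ⟩
  inv c * (c * a)    ≡⟨ cong (inv c *_) ca≡cb ⟩
  inv c * (c * b)    ≡⟨ unit b ⟨
  b                  ∎
  where
  open ≡-Reasoning
  unit : ∀ x → x ≡ inv c * (c * x)
  unit x = begin
    x                  ≡⟨ ℚP.*-identityˡ x ⟨
    1ℚ * x             ≡⟨ cong (_* x) (trans (sym (inv-inverseʳ c≢0)) (ℚP.*-comm c (inv c))) ⟩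
    (inv c * c) * x    ≡⟨ ℚP.*-assoc (inv c) c x ⟩
    inv c * (c * x)    ∎

inv-unique : ∀ {x y} → x * y ≡ 1ℚ → y ≡ inv x
inv-unique {x} {y} xy≡1 = *-cancelˡ-≢0 y (inv x) x≢0 (trans xy≡1 (sym (inv-inverseʳ x≢0)))
  where
  x≢0 : x ≢ 0ℚ
  x≢0 refl = ℚP.1≢0 (trans (sym xy≡1) (ℚP.*-zeroˡ y))

inv-distrib-* : ∀ x y → inv (x * y) ≡ inv x * inv y
inv-distrib-* x y = byCases (x ℚP.≟ 0ℚ) (y ℚP.≟ 0ℚ)
  where
  open ≡-Reasoning
  interchange : ∀ a b c d → (a * b) * (c * d) ≡ (a * c) * (b * d)
  interchange = solve-∀ ℚ-ring
  byCases : Dec (x ≡ 0ℚ) → Dec (y ≡ 0ℚ) → inv (x * y) ≡ inv x * inv y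
  byCases (yes refl) _ = trans (cong inv (ℚP.*-zeroˡ y)) (sym (ℚP.*-zeroˡ (inv y)))
  byCases _ (yes refl) = trans (cong inv (ℚP.*-zeroʳ x)) (sym (ℚP.*-zeroʳ (inv x)))
  byCases (no x≢0) (no y≢0) = sym (inv-unique {x * y} (begin
    (x * y) * (inv x * inv y)    ≡⟨ interchange x y (inv x) (inv y) ⟩
    (x * inv x) * (y * inv y)    ≡⟨ cong₂ _*_ (inv-inverseʳ x≢0) (inv-inverseʳ y≢0) ⟩
    1ℚ                           ∎))

^-distribˡ-+-* : ∀ x m n → x ^ (m ℕ.+ n) ≡ x ^ m * x ^ n
^-distribˡ-+-* x zero    n = sym (ℚP.*-identityˡ (x ^ n))
^-distribˡ-+-* x (suc m) n = trans (cong (x *_) (^-distribˡ-+-* x m n)) (sym (ℚP.*-assoc x (x ^ m) (x ^ n)))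

∣^∣ : ∀ x k → ℚ.∣ x ^ k ∣ ≡ ℚ.∣ x ∣ ^ k
∣^∣ x zero    = refl
∣^∣ x (suc k) = trans (ℚP.∣p*q∣≡∣p∣*∣q∣ x (x ^ k)) (cong (ℚ.∣ x ∣ *_) (∣^∣ x k))

^-suc≤ : ∀ {x} → 0ℚ ℚ.≤ x → x ℚ.≤ 1ℚ → ∀ k → x ^ suc k ℚ.≤ x
^-suc≤ {x} 0≤x x≤1 k =
  ℚP.≤-trans (ℚP.*-monoˡ-≤-nonNeg x {{ℚ.nonNegative 0≤x}} (^≤1 k)) (ℚP.≤-reflexive (ℚP.*-identityʳ x))
  where
  ^≤1 : ∀ k → x ^ k ℚ.≤ 1ℚ
  ^≤1 zero    = ℚP.≤-refl
  ^≤1 (suc k) = ℚP.≤-trans (^-suc≤ 0≤x x≤1 k) x≤1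

^-suc≥ : ∀ {x} → 1ℚ ℚ.≤ x → ∀ k → x ℚ.≤ x ^ suc k
^-suc≥ {x} 1≤x k =
  ℚP.≤-trans (ℚP.≤-reflexive (sym (ℚP.*-identityʳ x))) (ℚP.*-monoˡ-≤-nonNeg x {{ℚ.nonNegative 0≤x}} (1≤^ k))
  where
  0≤x : 0ℚ ℚ.≤ x
  0≤x = ℚP.≤-trans (ℚP.<⇒≤ (ℚP.positive⁻¹ 1ℚ)) 1≤x
  1≤^ : ∀ k → 1ℚ ℚ.≤ x ^ k
  1≤^ zero    = ℚP.≤-refl
  1≤^ (suc k) = ℚP.≤-trans 1≤x (^-suc≥ 1≤x k)

^-suc≡1⇒≡1 : ∀ {x} → 0ℚ ℚ.≤ x → ∀ k → x ^ suc k ≡ 1ℚ → x ≡ 1ℚ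
^-suc≡1⇒≡1 {x} 0≤x k xᵏ⁺¹≡1 with ℚP.<-cmp x 1ℚ
... | tri< x<1 _ _ = contradiction (ℚP.≤-<-trans (^-suc≤ 0≤x (ℚP.<⇒≤ x<1) k) x<1) (ℚP.<-irrefl xᵏ⁺¹≡1)
... | tri≈ _ x≡1 _ = x≡1
... | tri> _ _ x>1 = contradiction (ℚP.<-≤-trans x>1 (^-suc≥ (ℚP.<⇒≤ x>1) k)) (ℚP.<-irrefl (sym xᵏ⁺¹≡1))

^-suc≢1 : ∀ {q} → q ≢ 1ℚ → q ≢ - 1ℚ → ∀ k → q ^ suc k ≢ 1ℚ
^-suc≢1 {q} q≢1 q≢-1 k qᵏ⁺¹≡1
  with ℚP.∣p∣≡p∨∣p∣≡-p q
     | ^-suc≡1⇒≡1 (ℚP.0≤∣p∣ q) k (trans (sym (∣^∣ q (suc k))) (cong ℚ.∣_∣ qᵏ⁺¹≡1))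
... | inj₁ ∣q∣≡q  | ∣q∣≡1 = q≢1 (trans (sym ∣q∣≡q) ∣q∣≡1)
... | inj₂ ∣q∣≡-q | ∣q∣≡1 = q≢-1 (ℚP.neg-injective (trans (sym ∣q∣≡-q) ∣q∣≡1))

difference-step : ∀ Q A B X₁ X₂ {F₁ F₂ R₁ R₂} → Q * X₁ ≡ F₁ + R₁ → Q * X₂ ≡ F₂ + R₂ →
                  Q * (A * X₁ - B * X₂) ≡ (A * F₁ - B * F₂) + (A * R₁ - B * R₂)
difference-step Q A B X₁ X₂ {F₁} {F₂} {R₁} {R₂} QX₁≡ QX₂≡ = begin
  Q * (A * X₁ - B * X₂)              ≡⟨ expand Q A B X₁ X₂ ⟩
  A * (Q * X₁) - B * (Q * X₂)        ≡⟨ cong₂ (λ u v → A * u - B * v) QX₁≡ QX₂≡ ⟩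
  A * (F₁ + R₁) - B * (F₂ + R₂)      ≡⟨ regroup A B F₁ F₂ R₁ R₂ ⟩
  A * F₁ - B * F₂ + (A * R₁ - B * R₂) ∎
  where
  open ≡-Reasoning
  expand : ∀ Q A B X₁ X₂ → Q * (A * X₁ - B * X₂) ≡ A * (Q * X₁) - B * (Q * X₂)
  expand = solve-∀ ℚ-ring
  regroup : ∀ A B F₁ F₂ R₁ R₂ → A * (F₁ + R₁) - B * (F₂ + R₂) ≡ A * F₁ - B * F₂ + (A * R₁ - B * R₂)
  regroup = solve-∀ ℚ-ring

∑< : ℕ → (ℕ → ℚ) → ℚ
∑< zero    f = 0ℚ
∑< (suc n) f = ∑< n f + f n

syntax ∑< n (λ i → x) = ∑[ i < n ] x

∑-cong-< : ∀ n {f g : ℕ → ℚ} → (∀ i → i < n → f i ≡ g i) → ∑< n f ≡ ∑< n g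
∑-cong-< zero    f≡g = refl
∑-cong-< (suc n) f≡g = cong₂ _+_ (∑-cong-< n (λ i i<n → f≡g i (ℕP.m<n⇒m<1+n i<n))) (f≡g n ℕP.≤-refl)

∑-cong : ∀ n {f g : ℕ → ℚ} → (∀ i → f i ≡ g i) → ∑< n f ≡ ∑< n g
∑-cong n f≡g = ∑-cong-< n (λ i _ → f≡g i)

∑-zero : ∀ n {f : ℕ → ℚ} → (∀ i → i < n → f i ≡ 0ℚ) → ∑< n f ≡ 0ℚ
∑-zero zero    f≡0 = refl
∑-zero (suc n) f≡0 = cong₂ _+_ (∑-zero n (λ i i<n → f≡0 i (ℕP.m<n⇒m<1+n i<n))) (f≡0 n ℕP.≤-refl)

∑-distrib-+ : ∀ n (f g : ℕ → ℚ) → ∑[ i < n ] (f i + g i) ≡ ∑< n f + ∑< n g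
∑-distrib-+ zero    f g = refl
∑-distrib-+ (suc n) f g = trans (cong (_+ (f n + g n)) (∑-distrib-+ n f g)) (shuffle (∑< n f) (∑< n g) (f n) (g n))
  where
  shuffle : ∀ a b c d → (a + b) + (c + d) ≡ (a + c) + (b + d)
  shuffle = solve-∀ ℚ-ring

*-distribˡ-∑ : ∀ n c (f : ℕ → ℚ) → c * ∑< n f ≡ ∑[ i < n ] (c * f i)
*-distribˡ-∑ zero    c f = ℚP.*-zeroʳ c
*-distribˡ-∑ (suc n) c f = trans (ℚP.*-distribˡ-+ c (∑< n f) (f n)) (cong (_+ c * f n) (*-distribˡ-∑ n c f))

∑-suc : ∀ n (f : ℕ → ℚ) → ∑< (suc n) f ≡ f 0 + ∑[ i < n ] f (suc i)
∑-suc zero    f = ℚP.+-comm 0ℚ (f 0)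
∑-suc (suc n) f = trans (cong (_+ f (suc n)) (∑-suc n f)) (ℚP.+-assoc (f 0) _ _)

∑-split : ∀ m n (f : ℕ → ℚ) → ∑< (m ℕ.+ n) f ≡ ∑< m f + ∑[ i < n ] f (m ℕ.+ i)
∑-split m zero    f = trans (cong (λ k → ∑< k f) (ℕP.+-identityʳ m)) (sym (ℚP.+-identityʳ (∑< m f)))
∑-split m (suc n) f = begin
  ∑< (m ℕ.+ suc n) f                             ≡⟨ cong (λ k → ∑< k f) (ℕP.+-suc m n) ⟩
  ∑< (m ℕ.+ n) f + f (m ℕ.+ n)                   ≡⟨ cong (_+ f (m ℕ.+ n)) (∑-split m n f) ⟩
  ∑< m f + ∑[ i < n ] f (m ℕ.+ i) + f (m ℕ.+ n)  ≡⟨ ℚP.+-assoc (∑< m f) _ _ ⟩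
  ∑< m f + ∑[ i < suc n ] f (m ℕ.+ i)            ∎
  where open ≡-Reasoning

Σℚ-++ : ∀ (xs ys : List ℚ) → Σℚ (xs ++ ys) ≡ Σℚ xs + Σℚ ys
Σℚ-++ []       ys = sym (ℚP.+-identityˡ (Σℚ ys))
Σℚ-++ (x ∷ xs) ys = trans (cong (_+_ x) (Σℚ-++ xs ys)) (sym (ℚP.+-assoc x (Σℚ xs) (Σℚ ys)))

Σℚ-map-cong : ∀ {A : Set} {f g : A → ℚ} (xs : List A) → (∀ x → f x ≡ g x) → Σℚ (map f xs) ≡ Σℚ (map g xs)
Σℚ-map-cong []       f≡g = refl
Σℚ-map-cong (x ∷ xs) f≡g = cong₂ _+_ (f≡g x) (Σℚ-map-cong xs f≡g)

*-distribˡ-Σℚ : ∀ {A : Set} c (f : A → ℚ) (xs : List A) → c * Σℚ (map f xs) ≡ Σℚ (map (λ x → c * f x) xs)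
*-distribˡ-Σℚ c f []       = ℚP.*-zeroʳ c
*-distribˡ-Σℚ c f (x ∷ xs) = trans (ℚP.*-distribˡ-+ c (f x) _) (cong (_+_ (c * f x)) (*-distribˡ-Σℚ c f xs))

Σℚ-concatMap : ∀ {A B : Set} (f : B → ℚ) (g : A → List B) (xs : List A) →
               Σℚ (map f (concatMap g xs)) ≡ Σℚ (map (λ x → Σℚ (map f (g x))) xs)
Σℚ-concatMap f g []       = refl
Σℚ-concatMap f g (x ∷ xs) = begin
  Σℚ (map f (g x ++ concatMap g xs))                ≡⟨ cong Σℚ (ListP.map-++ f (g x) (concatMap g xs)) ⟩
  Σℚ (map f (g x) ++ map f (concatMap g xs))        ≡⟨ Σℚ-++ (map f (g x)) _ ⟩
  Σℚ (map f (g x)) + Σℚ (map f (concatMap g xs))    ≡⟨ cong (_+_ (Σℚ (map f (g x)))) (Σℚ-concatMap f g xs) ⟩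
  Σℚ (map f (g x)) + Σℚ (map (λ x → Σℚ (map f (g x))) xs) ∎
  where open ≡-Reasoning

Σℚ-applyUpTo : ∀ (f : ℕ → ℚ) g n → Σℚ (map f (applyUpTo g n)) ≡ ∑[ i < n ] f (g i)
Σℚ-applyUpTo f g zero    = refl
Σℚ-applyUpTo f g (suc n) = trans (cong (_+_ (f (g 0))) (Σℚ-applyUpTo f (g ∘ suc) n)) (sym (∑-suc n (f ∘ g)))

Σℚ-upTo : ∀ (f : ℕ → ℚ) n → Σℚ (map f (upTo n)) ≡ ∑< n f
Σℚ-upTo f = Σℚ-applyUpTo f (λ i → i)

symSum-cong : ∀ {f g : ℤ → ℚ} M → (∀ r → f r ≡ g r) → symSum f M ≡ symSum g M
symSum-cong zero    f≡g = f≡g _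
symSum-cong (suc M) f≡g = cong₂ _+_ (cong₂ _+_ (symSum-cong M f≡g) (f≡g _)) (f≡g _)

symSum-distrib-+ : ∀ (f g : ℤ → ℚ) M → symSum (λ r → f r + g r) M ≡ symSum f M + symSum g M
symSum-distrib-+ f g zero    = refl
symSum-distrib-+ f g (suc M) =
  trans (cong (λ s → s + (f (+ suc M) + g (+ suc M)) + (f -[1+ M ] + g -[1+ M ])) (symSum-distrib-+ f g M))
        (shuffle (symSum f M) (symSum g M) (f (+ suc M)) (g (+ suc M)) (f -[1+ M ]) (g -[1+ M ]))
  where
  shuffle : ∀ a b c d e h → a + b + (c + d) + (e + h) ≡ a + c + e + (b + d + h)
  shuffle = solve-∀ ℚ-ring

*-distribˡ-symSum : ∀ c (f : ℤ → ℚ) M → c * symSum f M ≡ symSum (λ r → c * f r) M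
*-distribˡ-symSum c f zero    = refl
*-distribˡ-symSum c f (suc M) =
  trans (distrib c (symSum f M) (f (+ suc M)) (f -[1+ M ])) (cong (λ s → s + c * f (+ suc M) + c * f -[1+ M ]) (*-distribˡ-symSum c f M))
  where
  distrib : ∀ c a b d → c * (a + b + d) ≡ c * a + c * b + c * d
  distrib = solve-∀ ℚ-ring

symSum-∑-comm : ∀ n (g : ℕ → ℤ → ℚ) M → symSum (λ r → ∑[ m < n ] g m r) M ≡ ∑[ m < n ] symSum (g m) M
symSum-∑-comm zero    g M = symSum-zero M
  where
  symSum-zero : ∀ M → symSum (λ _ → 0ℚ) M ≡ 0ℚ
  symSum-zero zero    = refl
  symSum-zero (suc M) = cong (λ s → s + 0ℚ + 0ℚ) (symSum-zero M)
symSum-∑-comm (suc n) g M =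
  trans (symSum-distrib-+ (λ r → ∑[ m < n ] g m r) (g n) M) (cong (_+ symSum (g n) M) (symSum-∑-comm n g M))

symSum-telescope : ∀ (h : ℤ → ℚ) L → symSum (λ s → h (s ℤ.- 1ℤ) - h s) L ≡ h -[1+ L ] - h (+ L)
symSum-telescope h zero    = refl
symSum-telescope h (suc L) = begin
  symSum F L + F (+ suc L) + F -[1+ L ]
    ≡⟨ cong (λ s → s + F (+ suc L) + F -[1+ L ]) (symSum-telescope h L) ⟩
  h -[1+ L ] - h (+ L) + (h (+ L) - h (+ suc L)) + (h (-[1+ L ] ℤ.- 1ℤ) - h -[1+ L ])
    ≡⟨ cancel (h -[1+ L ]) (h (+ L)) (h (+ suc L)) (h (-[1+ L ] ℤ.- 1ℤ)) ⟩
  h (-[1+ L ] ℤ.- 1ℤ) - h (+ suc L)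
    ≡⟨ cong (λ k → h -[1+ suc k ] - h (+ suc L)) (ℕP.+-identityʳ L) ⟩
  h -[1+ suc L ] - h (+ suc L) ∎
  where
  open ≡-Reasoning
  F = λ s → h (s ℤ.- 1ℤ) - h s
  cancel : ∀ a b c d → a - b + (b - c) + (d - a) ≡ d - c
  cancel = solve-∀ ℚ-ring

i*n/ℕn≡i : ∀ i n .{{_ : ℕ.NonZero n}} → (i ℤ.* + n) /ℕ n ≡ i
i*n/ℕn≡i (+ a) n = trans (cong (_/ℕ n) (sym (ℤP.pos-* a n))) (cong +_ (ℕD.m*n/n≡m a n))
i*n/ℕn≡i -[1+ a ] n@(suc n-1) with suc (n-1 ℕ.+ a ℕ.* n) ℕ.% n | ℕD.m*n%n≡0 (suc a) n
... | .0 | refl = cong (λ k → ℤ.- (+ k)) (ℕD.m*n/n≡m (suc a) n)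

data Parity : ℤ → Set where
  even : ∀ s → Parity (+ 2 ℤ.* s)
  odd  : ∀ s → Parity (+ 2 ℤ.* s ℤ.+ 1ℤ)

parity : ∀ r → Parity r
parity r with r ℤ.%ℕ 2 | ℤD.n%ℕd<d r 2 | ℤD.a≡a%ℕn+[a/ℕn]*n r 2
... | 0           | _             | r≡ = subst Parity (sym (trans r≡ (evenForm (r /ℕ 2)))) (even (r /ℕ 2))
  where
  evenForm : ∀ s → + 0 ℤ.+ s ℤ.* + 2 ≡ + 2 ℤ.* s
  evenForm = ℤ-Solver.solve-∀
... | 1           | _             | r≡ = subst Parity (sym (trans r≡ (oddForm (r /ℕ 2)))) (odd (r /ℕ 2))
  where
  oddForm : ∀ s → + 1 ℤ.+ s ℤ.* + 2 ≡ + 2 ℤ.* s ℤ.+ 1ℤ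
  oddForm = ℤ-Solver.solve-∀
... | suc (suc _) | s≤s (s≤s ()) | _

-1^2k≡1 : ∀ k → -1ℤ ℤ.^ (2 ℕ.* k) ≡ 1ℤ
-1^2k≡1 zero    = refl
-1^2k≡1 (suc k) = trans (cong (-1ℤ ℤ.^_) (ℕP.*-suc 2 k)) (cong (λ z → -1ℤ ℤ.* (-1ℤ ℤ.* z)) (-1^2k≡1 k))

sgnpow-even : ∀ s → sgnpow (+ 2 ℤ.* s) ≡ 1ℤ
sgnpow-even s = trans (cong (-1ℤ ℤ.^_) (ℤP.abs-* (+ 2) s)) (-1^2k≡1 ℤ.∣ s ∣)

sgnpow-odd : ∀ s → sgnpow (+ 2 ℤ.* s ℤ.+ 1ℤ) ≡ -1ℤ
sgnpow-odd (+ i) = trans (cong (λ z → sgnpow (z ℤ.+ 1ℤ)) (sym (ℤP.pos-* 2 i)))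
  (trans (cong (-1ℤ ℤ.^_) (ℕP.+-comm (2 ℕ.* i) 1)) (cong (-1ℤ ℤ.*_) (-1^2k≡1 i)))
sgnpow-odd -[1+ i ] = trans (cong sgnpow (negForm (+ i))) (trans (cong (λ z → sgnpow (ℤ.- (1ℤ ℤ.+ z))) (sym (ℤP.pos-* 2 i)))
  (cong (-1ℤ ℤ.*_) (-1^2k≡1 i)))
  where
  negForm : ∀ x → + 2 ℤ.* (ℤ.- (1ℤ ℤ.+ x)) ℤ.+ 1ℤ ≡ ℤ.- (1ℤ ℤ.+ + 2 ℤ.* x)
  negForm = ℤ-Solver.solve-∀

kk-even : ∀ s → kk (+ 2 ℤ.* s) ≡ + 3 ℤ.* s
kk-even s = begin
  (+ 6 ℤ.* (+ 2 ℤ.* s) ℤ.+ 1ℤ ℤ.- sgnpow (+ 2 ℤ.* s)) /ℕ 4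
    ≡⟨ cong (λ z → (+ 6 ℤ.* (+ 2 ℤ.* s) ℤ.+ 1ℤ ℤ.- z) /ℕ 4) (sgnpow-even s) ⟩
  (+ 6 ℤ.* (+ 2 ℤ.* s) ℤ.+ 1ℤ ℤ.- 1ℤ) /ℕ 4
    ≡⟨ cong (_/ℕ 4) (numerator s) ⟩
  (+ 3 ℤ.* s ℤ.* + 4) /ℕ 4
    ≡⟨ i*n/ℕn≡i (+ 3 ℤ.* s) 4 ⟩
  + 3 ℤ.* s ∎
  where
  open ≡-Reasoning
  numerator : ∀ s → + 6 ℤ.* (+ 2 ℤ.* s) ℤ.+ 1ℤ ℤ.- 1ℤ ≡ + 3 ℤ.* s ℤ.* + 4
  numerator = ℤ-Solver.solve-∀

kk-odd : ∀ s → kk (+ 2 ℤ.* s ℤ.+ 1ℤ) ≡ + 3 ℤ.* s ℤ.+ + 2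
kk-odd s = begin
  (+ 6 ℤ.* (+ 2 ℤ.* s ℤ.+ 1ℤ) ℤ.+ 1ℤ ℤ.- sgnpow (+ 2 ℤ.* s ℤ.+ 1ℤ)) /ℕ 4
    ≡⟨ cong (λ z → (+ 6 ℤ.* (+ 2 ℤ.* s ℤ.+ 1ℤ) ℤ.+ 1ℤ ℤ.- z) /ℕ 4) (sgnpow-odd s) ⟩
  (+ 6 ℤ.* (+ 2 ℤ.* s ℤ.+ 1ℤ) ℤ.+ 1ℤ ℤ.- -1ℤ) /ℕ 4
    ≡⟨ cong (_/ℕ 4) (numerator s) ⟩
  ((+ 3 ℤ.* s ℤ.+ + 2) ℤ.* + 4) /ℕ 4
    ≡⟨ i*n/ℕn≡i (+ 3 ℤ.* s ℤ.+ + 2) 4 ⟩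
  + 3 ℤ.* s ℤ.+ + 2 ∎
  where
  open ≡-Reasoning
  numerator : ∀ s → + 6 ℤ.* (+ 2 ℤ.* s ℤ.+ 1ℤ) ℤ.+ 1ℤ ℤ.- -1ℤ ≡ (+ 3 ℤ.* s ℤ.+ + 2) ℤ.* + 4
  numerator = ℤ-Solver.solve-∀

-- r(3r+1)/2 at r = 2s and at r = 2s + 1, as natural numbers so that q ^_ applies.
pentEven : ℤ → ℕ
pentEven (+ i)    = i ℕ.* (6 ℕ.* i ℕ.+ 1)
pentEven -[1+ i ] = suc i ℕ.* (6 ℕ.* i ℕ.+ 5)

pentOdd : ℤ → ℕ
pentOdd (+ i)    = (2 ℕ.* i ℕ.+ 1) ℕ.* (3 ℕ.* i ℕ.+ 2)
pentOdd -[1+ i ] = (2 ℕ.* i ℕ.+ 1) ℕ.* (3 ℕ.* i ℕ.+ 1)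

pos-affine : ∀ a i b → + (a ℕ.* i ℕ.+ b) ≡ + a ℤ.* + i ℤ.+ + b
pos-affine a i b = trans (ℤP.pos-+ (a ℕ.* i) b) (cong (ℤ._+ + b) (ℤP.pos-* a i))

+pentEven : ∀ s → + pentEven s ≡ s ℤ.* (+ 6 ℤ.* s ℤ.+ 1ℤ)
+pentEven (+ i)    = trans (ℤP.pos-* i _) (cong (+ i ℤ.*_) (pos-affine 6 i 1))
+pentEven -[1+ i ] = trans (ℤP.pos-* (suc i) _) (trans (cong (+ suc i ℤ.*_) (pos-affine 6 i 5)) (sym (negForm (+ i))))
  where
  negForm : ∀ x → ℤ.- (1ℤ ℤ.+ x) ℤ.* (+ 6 ℤ.* ℤ.- (1ℤ ℤ.+ x) ℤ.+ 1ℤ) ≡ (1ℤ ℤ.+ x) ℤ.* (+ 6 ℤ.* x ℤ.+ + 5)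
  negForm = ℤ-Solver.solve-∀

+pentOdd : ∀ s → + pentOdd s ≡ (+ 2 ℤ.* s ℤ.+ 1ℤ) ℤ.* (+ 3 ℤ.* s ℤ.+ + 2)
+pentOdd (+ i)    = trans (ℤP.pos-* (2 ℕ.* i ℕ.+ 1) _) (cong₂ ℤ._*_ (pos-affine 2 i 1) (pos-affine 3 i 2))
+pentOdd -[1+ i ] = trans (ℤP.pos-* (2 ℕ.* i ℕ.+ 1) _)
  (trans (cong₂ ℤ._*_ (pos-affine 2 i 1) (pos-affine 3 i 1)) (sym (negForm (+ i))))
  where
  negForm : ∀ x → (+ 2 ℤ.* ℤ.- (1ℤ ℤ.+ x) ℤ.+ 1ℤ) ℤ.* (+ 3 ℤ.* ℤ.- (1ℤ ℤ.+ x) ℤ.+ + 2)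
                  ≡ (+ 2 ℤ.* x ℤ.+ 1ℤ) ℤ.* (+ 3 ℤ.* x ℤ.+ 1ℤ)
  negForm = ℤ-Solver.solve-∀

pent-even : ∀ s → pent (+ 2 ℤ.* s) ≡ + pentEven s
pent-even s = trans (cong (_/ℕ 2) (numerator s)) (trans (i*n/ℕn≡i _ 2) (sym (+pentEven s)))
  where
  numerator : ∀ s → + 2 ℤ.* s ℤ.* (+ 3 ℤ.* (+ 2 ℤ.* s) ℤ.+ 1ℤ) ≡ s ℤ.* (+ 6 ℤ.* s ℤ.+ 1ℤ) ℤ.* + 2
  numerator = ℤ-Solver.solve-∀

pent-odd : ∀ s → pent (+ 2 ℤ.* s ℤ.+ 1ℤ) ≡ + pentOdd s
pent-odd s = trans (cong (_/ℕ 2) (numerator s)) (trans (i*n/ℕn≡i _ 2) (sym (+pentOdd s)))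
  where
  numerator : ∀ s → (+ 2 ℤ.* s ℤ.+ 1ℤ) ℤ.* (+ 3 ℤ.* (+ 2 ℤ.* s ℤ.+ 1ℤ) ℤ.+ 1ℤ)
                    ≡ (+ 2 ℤ.* s ℤ.+ 1ℤ) ℤ.* (+ 3 ℤ.* s ℤ.+ + 2) ℤ.* + 2
  numerator = ℤ-Solver.solve-∀

pent-nonneg : ∀ r → + ℤ.∣ pent r ∣ ≡ pent r
pent-nonneg r with parity r
... | even s = trans (cong (λ z → + ℤ.∣ z ∣) (pent-even s)) (sym (pent-even s))
... | odd s  = trans (cong (λ z → + ℤ.∣ z ∣) (pent-odd s)) (sym (pent-odd s))

2*+[1+_] : ∀ L → + 2 ℤ.* + suc L ≡ + suc (suc (2 ℕ.* L))
2*+[1+ L ] = trans (sym (ℤP.pos-* 2 (suc L))) (cong +_ (ℕP.*-suc 2 L))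

2*+_+1 : ∀ L → + 2 ℤ.* + L ℤ.+ 1ℤ ≡ + suc (2 ℕ.* L)
2*+ L +1 = trans (cong (ℤ._+ 1ℤ) (sym (ℤP.pos-* 2 L))) (cong +_ (ℕP.+-comm (2 ℕ.* L) 1))

2*-[1+_] : ∀ L → + 2 ℤ.* -[1+ L ] ≡ -[1+ suc (2 ℕ.* L) ]
2*-[1+ L ] = trans (sym (ℤP.neg-distribʳ-* (+ 2) (+ suc L))) (cong ℤ.-_ (2*+[1+ L ]))

2*-[1+_]+1 : ∀ L → + 2 ℤ.* -[1+ L ] ℤ.+ 1ℤ ≡ -[1+ 2 ℕ.* L ]
2*-[1+ L ]+1 = cong (ℤ._+ 1ℤ) (2*-[1+ L ])

symSum-pairs : ∀ (f : ℤ → ℚ) L →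
  symSum f (2 ℕ.* L) + f (+ suc (2 ℕ.* L)) ≡ symSum (λ s → f (+ 2 ℤ.* s) + f (+ 2 ℤ.* s ℤ.+ 1ℤ)) L
symSum-pairs f zero    = refl
symSum-pairs f (suc L) = begin
  symSum f (2 ℕ.* suc L) + f (+ suc (2 ℕ.* suc L))
    ≡⟨ cong (λ k → symSum f k + f (+ suc k)) (ℕP.*-suc 2 L) ⟩
  symSum f (2 ℕ.* L) + f (+ suc (2 ℕ.* L)) + f -[1+ 2 ℕ.* L ] + f (+ suc (suc (2 ℕ.* L)))
    + f -[1+ suc (2 ℕ.* L) ] + f (+ suc (suc (suc (2 ℕ.* L))))
    ≡⟨ regroup (symSum f (2 ℕ.* L)) (f (+ suc (2 ℕ.* L))) (f -[1+ 2 ℕ.* L ]) (f (+ suc (suc (2 ℕ.* L))))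
               (f -[1+ suc (2 ℕ.* L) ]) (f (+ suc (suc (suc (2 ℕ.* L))))) ⟩
  symSum f (2 ℕ.* L) + f (+ suc (2 ℕ.* L))
    + (f (+ suc (suc (2 ℕ.* L))) + f (+ suc (suc (suc (2 ℕ.* L)))))
    + (f -[1+ suc (2 ℕ.* L) ] + f -[1+ 2 ℕ.* L ])
    ≡⟨ cong₂ (λ u v → u + v + (f -[1+ suc (2 ℕ.* L) ] + f -[1+ 2 ℕ.* L ])) (symSum-pairs f L)
             (cong₂ _+_ (cong f (sym (2*+[1+ L ]))) (cong f (sym (trans (2*+ suc L +1) (cong (λ k → + suc k) (ℕP.*-suc 2 L)))))) ⟩
  symSum g L + g (+ suc L) + (f -[1+ suc (2 ℕ.* L) ] + f -[1+ 2 ℕ.* L ])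
    ≡⟨ cong (λ v → symSum g L + g (+ suc L) + v) (cong₂ _+_ (cong f (sym (2*-[1+ L ]))) (cong f (sym (2*-[1+ L ]+1)))) ⟩
  symSum g (suc L) ∎
  where
  open ≡-Reasoning
  g = λ s → f (+ 2 ℤ.* s) + f (+ 2 ℤ.* s ℤ.+ 1ℤ)
  regroup : ∀ S a b c d e → S + a + b + c + d + e ≡ S + a + (c + e) + (d + b)
  regroup = solve-∀ ℚ-ring

+∣i∣*∣i∣ : ∀ i → + (ℤ.∣ i ∣ ℕ.* ℤ.∣ i ∣) ≡ i ℤ.* i
+∣i∣*∣i∣ (+ a)    = ℤP.pos-* a a
+∣i∣*∣i∣ -[1+ a ] = refl

exponent-nonneg : ∀ p r → + (ℤ.∣ pent r ∣ ℕ.+ p ℕ.* (ℤ.∣ kk r ∣ ℕ.* ℤ.∣ kk r ∣))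
                          ≡ pent r ℤ.+ + p ℤ.* (kk r ℤ.* kk r)
exponent-nonneg p r = begin
  + (ℤ.∣ pent r ∣ ℕ.+ p ℕ.* K)       ≡⟨ ℤP.pos-+ ℤ.∣ pent r ∣ (p ℕ.* K) ⟩
  + ℤ.∣ pent r ∣ ℤ.+ + (p ℕ.* K)     ≡⟨ cong₂ ℤ._+_ (pent-nonneg r) (ℤP.pos-* p K) ⟩
  pent r ℤ.+ + p ℤ.* + K             ≡⟨ cong (λ z → pent r ℤ.+ + p ℤ.* z) (+∣i∣*∣i∣ (kk r)) ⟩
  pent r ℤ.+ + p ℤ.* (kk r ℤ.* kk r) ∎
  where
  open ≡-Reasoning
  K = ℤ.∣ kk r ∣ ℕ.* ℤ.∣ kk r ∣

∣kk[2L+1]∣ : ∀ L → ℤ.∣ kk (+ suc (2 ℕ.* L)) ∣ ≡ 3 ℕ.* L ℕ.+ 2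
∣kk[2L+1]∣ L = cong ℤ.∣_∣ (trans (cong kk (sym (2*+ L +1))) (trans (kk-odd (+ L)) (sym (pos-affine 3 L 2))))

∣kk[-2L-1]∣ : ∀ L → ℤ.∣ kk -[1+ 2 ℕ.* L ] ∣ ≡ suc (3 ℕ.* L)
∣kk[-2L-1]∣ L = cong ℤ.∣_∣ (trans (cong kk (sym (2*-[1+ L ]+1)))
                          (trans (kk-odd -[1+ L ]) (trans (index (+ L)) (cong (λ w → ℤ.- (1ℤ ℤ.+ w)) (sym (ℤP.pos-* 3 L))))))
  where
  index : ∀ x → + 3 ℤ.* ℤ.- (1ℤ ℤ.+ x) ℤ.+ + 2 ≡ ℤ.- (1ℤ ℤ.+ + 3 ℤ.* x)
  index = ℤ-Solver.solve-∀

even-or-odd : ∀ M → ∃[ L ] (2 ℕ.* L ≡ M ⊎ suc (2 ℕ.* L) ≡ M)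
even-or-odd zero = 0 , inj₁ refl
even-or-odd (suc M) with even-or-odd M
... | L , inj₁ refl = L , inj₂ refl
... | L , inj₂ refl = suc L , inj₁ (ℕP.*-suc 2 L)

module QSeries (q : ℚ) (q^suc≢1 : ∀ k → q ^ suc k ≢ 1ℚ) where

  1-q^suc≢0 : ∀ k → 1ℚ - q ^ suc k ≢ 0ℚ
  1-q^suc≢0 k 1-qᵏ⁺¹≡0 = q^suc≢1 k (trans (flip (q ^ suc k)) (cong (_-_ 1ℚ) 1-qᵏ⁺¹≡0))
    where
    flip : ∀ x → x ≡ 1ℚ - (1ℚ - x)
    flip = solve-∀ ℚ-ring

  1/qq : ℕ → ℚ
  1/qq m = inv (qq q m)

  1/qq-suc : ∀ m → (1ℚ - q ^ suc m) * 1/qq (suc m) ≡ 1/qq m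
  1/qq-suc m = begin
    c * inv (qq q m * c)        ≡⟨ cong (c *_) (inv-distrib-* (qq q m) c) ⟩
    c * (1/qq m * inv c)        ≡⟨ rearrange c (1/qq m) (inv c) ⟩
    1/qq m * (c * inv c)        ≡⟨ cong (1/qq m *_) (inv-inverseʳ (1-q^suc≢0 m)) ⟩
    1/qq m * 1ℚ                 ≡⟨ ℚP.*-identityʳ (1/qq m) ⟩
    1/qq m                      ∎
    where
    open ≡-Reasoning
    c = 1ℚ - q ^ suc m
    rearrange : ∀ a b d → a * (b * d) ≡ b * (a * d)
    rearrange = solve-∀ ℚ-ring

  1/qqℤ : ℤ → ℚ
  1/qqℤ (+ m)    = 1/qq m
  1/qqℤ -[1+ _ ] = 0ℚ

  1/qqℤ-pred : ∀ m → (1ℚ - q ^ m) * 1/qqℤ (+ m) ≡ 1/qqℤ (+ m ℤ.- 1ℤ)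
  1/qqℤ-pred zero    = refl
  1/qqℤ-pred (suc m) = 1/qq-suc m

  1/qqℤ-∸ : ∀ {m j} → j ≤ m → 1/qqℤ (+ m ℤ.- + j) ≡ 1/qq (m ∸ j)
  1/qqℤ-∸ {m} {j} j≤m = cong 1/qqℤ (trans (ℤP.m-n≡m⊖n m j) (ℤP.⊖-≥ j≤m))

  1/qqℤ-< : ∀ {m j} → m < j → 1/qqℤ (+ m ℤ.- + j) ≡ 0ℚ
  1/qqℤ-< {m} {j} m<j with j ∸ m | ℕP.m<n⇒0<n∸m m<j | trans (ℤP.m-n≡m⊖n m j) (ℤP.⊖-< m<j)
  ... | suc _ | _ | m-j≡ = cong 1/qqℤ m-j≡

  pascalˡ : ∀ a b → (1ℚ - q ^ℤ (a ℤ.+ b)) * (1/qqℤ a * 1/qqℤ b)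
                    ≡ 1/qqℤ (a ℤ.- 1ℤ) * 1/qqℤ b + q ^ℤ a * (1/qqℤ a * 1/qqℤ (b ℤ.- 1ℤ))
  pascalˡ a@(-[1+ _ ]) b = vanishes (1ℚ - q ^ℤ (a ℤ.+ b)) (1/qqℤ b) (q ^ℤ a) (1/qqℤ (b ℤ.- 1ℤ))
    where
    vanishes : ∀ c x w y → c * (0ℚ * x) ≡ 0ℚ * x + w * (0ℚ * y)
    vanishes = solve-∀ ℚ-ring
  pascalˡ (+ x) b@(-[1+ _ ]) = vanishes (1ℚ - q ^ℤ (+ x ℤ.+ b)) (1/qq x) (1/qqℤ (+ x ℤ.- 1ℤ)) (q ^ x)
    where
    vanishes : ∀ c x x′ w → c * (x * 0ℚ) ≡ x′ * 0ℚ + w * (x * 0ℚ)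
    vanishes = solve-∀ ℚ-ring
  pascalˡ (+ x) (+ y) = begin
    (1ℚ - q ^ (x ℕ.+ y)) * (1/qq x * 1/qq y)
      ≡⟨ cong (λ z → (1ℚ - z) * (1/qq x * 1/qq y)) (^-distribˡ-+-* q x y) ⟩
    (1ℚ - q ^ x * q ^ y) * (1/qq x * 1/qq y)
      ≡⟨ split (q ^ x) (q ^ y) (1/qq x) (1/qq y) ⟩
    ((1ℚ - q ^ x) * 1/qq x) * 1/qq y + q ^ x * (1/qq x * ((1ℚ - q ^ y) * 1/qq y))
      ≡⟨ cong₂ (λ u v → u * 1/qq y + q ^ x * (1/qq x * v)) (1/qqℤ-pred x) (1/qqℤ-pred y) ⟩
    1/qqℤ (+ x ℤ.- 1ℤ) * 1/qq y + q ^ x * (1/qq x * 1/qqℤ (+ y ℤ.- 1ℤ)) ∎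
    where
    open ≡-Reasoning
    split : ∀ X Y P Q → (1ℚ - X * Y) * (P * Q) ≡ ((1ℚ - X) * P) * Q + X * (P * ((1ℚ - Y) * Q))
    split = solve-∀ ℚ-ring

  pascalʳ : ∀ a b → (1ℚ - q ^ℤ (a ℤ.+ b)) * (1/qqℤ a * 1/qqℤ b)
                    ≡ 1/qqℤ a * 1/qqℤ (b ℤ.- 1ℤ) + q ^ℤ b * (1/qqℤ (a ℤ.- 1ℤ) * 1/qqℤ b)
  pascalʳ a b = begin
    (1ℚ - q ^ℤ (a ℤ.+ b)) * (1/qqℤ a * 1/qqℤ b)
      ≡⟨ cong₂ (λ e z → (1ℚ - q ^ℤ e) * z) (ℤP.+-comm a b) (ℚP.*-comm (1/qqℤ a) (1/qqℤ b)) ⟩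
    (1ℚ - q ^ℤ (b ℤ.+ a)) * (1/qqℤ b * 1/qqℤ a)
      ≡⟨ pascalˡ b a ⟩
    1/qqℤ (b ℤ.- 1ℤ) * 1/qqℤ a + q ^ℤ b * (1/qqℤ b * 1/qqℤ (a ℤ.- 1ℤ))
      ≡⟨ cong₂ (λ u v → u + q ^ℤ b * v)
               (ℚP.*-comm (1/qqℤ (b ℤ.- 1ℤ)) (1/qqℤ a)) (ℚP.*-comm (1/qqℤ b) (1/qqℤ (a ℤ.- 1ℤ))) ⟩
    1/qqℤ a * 1/qqℤ (b ℤ.- 1ℤ) + q ^ℤ b * (1/qqℤ (a ℤ.- 1ℤ) * 1/qqℤ b) ∎
    where open ≡-Reasoning

  -- The same rules with every index given up to a provable equality, so the ℤ arithmetic is done at the call site.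
  pascalˡ-at : ∀ a b {c a₀ b₀ a₁ b₁} → a ℤ.+ b ≡ c → a ≡ a₀ → b ≡ b₀ → a ℤ.- 1ℤ ≡ a₁ → b ℤ.- 1ℤ ≡ b₁ →
               (1ℚ - q ^ℤ c) * (1/qqℤ a * 1/qqℤ b) ≡ 1/qqℤ a₁ * 1/qqℤ b₀ + q ^ℤ a₀ * (1/qqℤ a₀ * 1/qqℤ b₁)
  pascalˡ-at a b refl refl refl refl refl = pascalˡ a b

  pascalʳ-at : ∀ a b {c a₀ b₀ a₁ b₁} → a ℤ.+ b ≡ c → a ≡ a₀ → b ≡ b₀ → a ℤ.- 1ℤ ≡ a₁ → b ℤ.- 1ℤ ≡ b₁ →
               (1ℚ - q ^ℤ c) * (1/qqℤ a * 1/qqℤ b) ≡ 1/qqℤ a₀ * 1/qqℤ b₁ + q ^ℤ b₀ * (1/qqℤ a₁ * 1/qqℤ b₀)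
  pascalʳ-at a b refl refl refl refl refl = pascalʳ a b

  -- q ^ℤ_ is not additive (q may be 0), but on the support of 1/qqℤ x * 1/qqℤ y all exponents are nonnegative.
  ^ℤ-shift : ∀ e₁ e₂ x y → + e₁ ℤ.+ x ≡ + e₂ ℤ.+ y →
             q ^ e₁ * (q ^ℤ x * (1/qqℤ x * 1/qqℤ y)) ≡ q ^ e₂ * (q ^ℤ y * (1/qqℤ x * 1/qqℤ y))
  ^ℤ-shift e₁ e₂ x@(-[1+ _ ]) y _ = trans (vanishes (q ^ e₁) (q ^ℤ x) (1/qqℤ y)) (sym (vanishes (q ^ e₂) (q ^ℤ y) (1/qqℤ y)))
    where
    vanishes : ∀ a b c → a * (b * (0ℚ * c)) ≡ 0ℚ
    vanishes = solve-∀ ℚ-ring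
  ^ℤ-shift e₁ e₂ (+ x) y@(-[1+ _ ]) _ = trans (vanishes (q ^ e₁) (q ^ x) (1/qq x)) (sym (vanishes (q ^ e₂) (q ^ℤ y) (1/qq x)))
    where
    vanishes : ∀ a b c → a * (b * (c * 0ℚ)) ≡ 0ℚ
    vanishes = solve-∀ ℚ-ring
  ^ℤ-shift e₁ e₂ (+ x) (+ y) e₁+x≡e₂+y = begin
    q ^ e₁ * (q ^ x * P)      ≡⟨ ℚP.*-assoc (q ^ e₁) (q ^ x) P ⟨
    q ^ e₁ * q ^ x * P        ≡⟨ cong (_* P) (^-distribˡ-+-* q e₁ x) ⟨
    q ^ (e₁ ℕ.+ x) * P        ≡⟨ cong (λ e → q ^ e * P) (ℤP.+-injective e₁+x≡e₂+y) ⟩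
    q ^ (e₂ ℕ.+ y) * P        ≡⟨ cong (_* P) (^-distribˡ-+-* q e₂ y) ⟩
    q ^ e₂ * q ^ y * P        ≡⟨ ℚP.*-assoc (q ^ e₂) (q ^ y) P ⟩
    q ^ e₂ * (q ^ y * P)      ∎
    where
    open ≡-Reasoning
    P = 1/qq x * 1/qq y

  kernel : ℕ → ℕ → ℕ → ℚ
  kernel N a i = q ^ (i ℕ.* i ℕ.+ a ℕ.* i) * 1/qq (N ∸ i) * 1/qq i * 1/qq (i ℕ.+ a)

  -- The two parts of (1 - q^N) * kernel N a i obtained from 1 - q^N = (1 - q^i) + q^i (1 - q^(N-i)).
  kernelˡ kernelʳ : ℕ → ℕ → ℕ → ℚ
  kernelˡ N a i = q ^ (i ℕ.* i ℕ.+ a ℕ.* i) * 1/qq (N ∸ i) * ((1ℚ - q ^ i) * 1/qq i) * 1/qq (i ℕ.+ a)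
  kernelʳ N a i = q ^ (i ℕ.* i ℕ.+ a ℕ.* i) * q ^ i * ((1ℚ - q ^ (N ∸ i)) * 1/qq (N ∸ i)) * 1/qq i * 1/qq (i ℕ.+ a)

  kernel-split : ∀ N a i → i ≤ N → (1ℚ - q ^ N) * kernel N a i ≡ kernelˡ N a i + kernelʳ N a i
  kernel-split N a i i≤N = trans (cong (λ z → (1ℚ - z) * kernel N a i) q^N≡q^i*q^[N-i])
    (distribute (q ^ i) (q ^ (N ∸ i)) (q ^ (i ℕ.* i ℕ.+ a ℕ.* i)) (1/qq (N ∸ i)) (1/qq i) (1/qq (i ℕ.+ a)))
    where
    q^N≡q^i*q^[N-i] : q ^ N ≡ q ^ i * q ^ (N ∸ i)
    q^N≡q^i*q^[N-i] = trans (cong (q ^_) (sym (ℕP.m+[n∸m]≡n i≤N))) (^-distribˡ-+-* q i (N ∸ i))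
    distribute : ∀ x y E J K L → (1ℚ - x * y) * (E * J * K * L) ≡ E * J * ((1ℚ - x) * K) * L + E * x * ((1ℚ - y) * J) * K * L
    distribute = solve-∀ ℚ-ring

  kernelˡ-zero : ∀ N a → kernelˡ N a 0 ≡ 0ℚ
  kernelˡ-zero N a = vanishes (q ^ (a ℕ.* 0)) (1/qq N) 1ℚ (1/qq a)
    where
    vanishes : ∀ E J K L → E * J * ((1ℚ - 1ℚ) * K) * L ≡ 0ℚ
    vanishes = solve-∀ ℚ-ring

  kernelʳ-last : ∀ N a → kernelʳ N a N ≡ 0ℚ
  kernelʳ-last N a rewrite ℕP.n∸n≡0 N = vanishes (q ^ (N ℕ.* N ℕ.+ a ℕ.* N)) (q ^ N) 1ℚ (1/qq N) (1/qq (N ℕ.+ a))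
    where
    vanishes : ∀ E x J K L → E * x * ((1ℚ - 1ℚ) * J) * K * L ≡ 0ℚ
    vanishes = solve-∀ ℚ-ring

  kernel-merge : ∀ N a i → i ≤ N → kernelˡ (suc N) a (suc i) + kernelʳ (suc N) a i ≡ kernel N (suc a) i
  kernel-merge N a i i≤N = begin
    kernelˡ (suc N) a (suc i) + kernelʳ (suc N) a i
      ≡⟨ cong₂ _+_ kernelˡ-shifted kernelʳ-rewritten ⟩
    E * q ^ suc (i ℕ.+ a) * 1/qq (N ∸ i) * 1/qq i * 1/qq (suc (i ℕ.+ a))
      + E * 1/qq (N ∸ i) * 1/qq i * ((1ℚ - q ^ suc (i ℕ.+ a)) * 1/qq (suc (i ℕ.+ a)))
      ≡⟨ recombine E (q ^ suc (i ℕ.+ a)) (1/qq (N ∸ i)) (1/qq i) (1/qq (suc (i ℕ.+ a))) ⟩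
    E * 1/qq (N ∸ i) * 1/qq i * 1/qq (suc (i ℕ.+ a))
      ≡⟨ cong (λ k → E * 1/qq (N ∸ i) * 1/qq i * 1/qq k) (sym (ℕP.+-suc i a)) ⟩
    kernel N (suc a) i ∎
    where
    open ≡-Reasoning
    E = q ^ (i ℕ.* i ℕ.+ suc a ℕ.* i)
    recombine : ∀ E y J K R → E * y * J * K * R + E * J * K * ((1ℚ - y) * R) ≡ E * J * K * R
    recombine = solve-∀ ℚ-ring
    exponentˡ : ∀ i a → suc i ℕ.* suc i ℕ.+ a ℕ.* suc i ≡ (i ℕ.* i ℕ.+ suc a ℕ.* i) ℕ.+ suc (i ℕ.+ a)
    exponentˡ = ℕ-Solver.solve-∀
    exponentʳ : ∀ i a → (i ℕ.* i ℕ.+ a ℕ.* i) ℕ.+ i ≡ i ℕ.* i ℕ.+ suc a ℕ.* i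
    exponentʳ = ℕ-Solver.solve-∀
    kernelˡ-shifted : kernelˡ (suc N) a (suc i) ≡ E * q ^ suc (i ℕ.+ a) * 1/qq (N ∸ i) * 1/qq i * 1/qq (suc (i ℕ.+ a))
    kernelˡ-shifted = cong₂ (λ u v → u * 1/qq (N ∸ i) * v * 1/qq (suc (i ℕ.+ a)))
      (trans (cong (q ^_) (exponentˡ i a)) (^-distribˡ-+-* q (i ℕ.* i ℕ.+ suc a ℕ.* i) (suc (i ℕ.+ a))))
      (1/qq-suc i)
    kernelʳ-rewritten : kernelʳ (suc N) a i ≡ E * 1/qq (N ∸ i) * 1/qq i * ((1ℚ - q ^ suc (i ℕ.+ a)) * 1/qq (suc (i ℕ.+ a)))
    kernelʳ-rewritten rewrite ℕP.+-∸-assoc 1 i≤N = cong₃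
      (trans (sym (^-distribˡ-+-* q (i ℕ.* i ℕ.+ a ℕ.* i) i)) (cong (q ^_) (exponentʳ i a)))
      (1/qq-suc (N ∸ i)) (sym (1/qq-suc (i ℕ.+ a)))
      where
      cong₃ : ∀ {u u′ v v′ w w′} → u ≡ u′ → v ≡ v′ → w ≡ w′ → u * v * 1/qq i * w ≡ u′ * v′ * 1/qq i * w′
      cong₃ refl refl refl = refl

  -- Multiply by 1 - q^(N+1), split each term, shift the first parts, and recombine into the case (N, a + 1).
  ∑-kernel : ∀ N a → ∑< (suc N) (kernel N a) ≡ 1/qq N * 1/qq (N ℕ.+ a)
  ∑-kernel zero a = begin
    0ℚ + q ^ (a ℕ.* 0) * 1ℚ * 1ℚ * 1/qq a   ≡⟨ cong (λ e → 0ℚ + q ^ e * 1ℚ * 1ℚ * 1/qq a) (ℕP.*-zeroʳ a) ⟩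
    0ℚ + 1ℚ * 1ℚ * 1ℚ * 1/qq a              ≡⟨ unit (1/qq a) ⟩
    1ℚ * 1/qq a                             ∎
    where
    open ≡-Reasoning
    unit : ∀ x → 0ℚ + 1ℚ * 1ℚ * 1ℚ * x ≡ 1ℚ * x
    unit = solve-∀ ℚ-ring
  ∑-kernel (suc N) a = *-cancelˡ-≢0 _ _ (1-q^suc≢0 N) (begin
    c * ∑< (suc (suc N)) (kernel (suc N) a)
      ≡⟨ *-distribˡ-∑ (suc (suc N)) c _ ⟩
    ∑[ i < suc (suc N) ] (c * kernel (suc N) a i)
      ≡⟨ ∑-cong-< (suc (suc N)) (λ i i<N+2 → kernel-split (suc N) a i (ℕP.≤-pred i<N+2)) ⟩
    ∑[ i < suc (suc N) ] (A i + B i)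
      ≡⟨ ∑-distrib-+ (suc (suc N)) A B ⟩
    ∑< (suc (suc N)) A + (∑< (suc N) B + B (suc N))
      ≡⟨ cong₂ _+_ (∑-suc (suc N) A) (cong (_+_ (∑< (suc N) B)) (kernelʳ-last (suc N) a)) ⟩
    (A 0 + ∑[ i < suc N ] A (suc i)) + (∑< (suc N) B + 0ℚ)
      ≡⟨ cong₂ _+_ (cong (_+ ∑[ i < suc N ] A (suc i)) (kernelˡ-zero (suc N) a)) (ℚP.+-identityʳ _) ⟩
    (0ℚ + ∑[ i < suc N ] A (suc i)) + ∑< (suc N) B
      ≡⟨ cong (_+ ∑< (suc N) B) (ℚP.+-identityˡ (∑[ i < suc N ] A (suc i))) ⟩
    ∑[ i < suc N ] A (suc i) + ∑< (suc N) B
      ≡⟨ ∑-distrib-+ (suc N) (A ∘ suc) B ⟨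
    ∑[ i < suc N ] (A (suc i) + B i)
      ≡⟨ ∑-cong-< (suc N) (λ i i<N+1 → kernel-merge N a i (ℕP.≤-pred i<N+1)) ⟩
    ∑< (suc N) (kernel N (suc a))
      ≡⟨ ∑-kernel N (suc a) ⟩
    1/qq N * 1/qq (N ℕ.+ suc a)
      ≡⟨ cong₂ (λ u v → u * 1/qq v) (1/qq-suc N) (sym (ℕP.+-suc N a)) ⟨
    (c * 1/qq (suc N)) * 1/qq (suc N ℕ.+ a)
      ≡⟨ ℚP.*-assoc c _ _ ⟩
    c * (1/qq (suc N) * 1/qq (suc N ℕ.+ a)) ∎)
    where
    open ≡-Reasoning
    c = 1ℚ - q ^ suc N
    A = kernelˡ (suc N) a
    B = kernelʳ (suc N) a

  baileyTerm : ℕ → ℤ → ℕ → ℚ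
  baileyTerm n k m = q ^ (m ℕ.* m) * 1/qq (n ∸ m) * (1/qqℤ (+ m ℤ.- k) * 1/qqℤ (+ m ℤ.+ k))

  -- The terms with m < j vanish, the others are q^(j²) times kernel N (2j) (m - j).
  bailey-sum-+ : ∀ j N → ∑< (suc (j ℕ.+ N)) (baileyTerm (j ℕ.+ N) (+ j))
                         ≡ q ^ (j ℕ.* j) * (1/qqℤ (+ (j ℕ.+ N) ℤ.- + j) * 1/qq (j ℕ.+ N ℕ.+ j))
  bailey-sum-+ j N = begin
    ∑< (suc (j ℕ.+ N)) t                                       ≡⟨ cong (λ k → ∑< k t) (sym (ℕP.+-suc j N)) ⟩
    ∑< (j ℕ.+ suc N) t                                         ≡⟨ ∑-split j (suc N) t ⟩
    ∑< j t + ∑[ i < suc N ] t (j ℕ.+ i)                        ≡⟨ cong₂ _+_ (∑-zero j low-terms) (∑-cong (suc N) shift) ⟩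
    0ℚ + ∑[ i < suc N ] (q ^ (j ℕ.* j) * kernel N (j ℕ.+ j) i) ≡⟨ ℚP.+-identityˡ _ ⟩
    ∑[ i < suc N ] (q ^ (j ℕ.* j) * kernel N (j ℕ.+ j) i)      ≡⟨ *-distribˡ-∑ (suc N) (q ^ (j ℕ.* j)) (kernel N (j ℕ.+ j)) ⟨
    q ^ (j ℕ.* j) * ∑< (suc N) (kernel N (j ℕ.+ j))            ≡⟨ cong (q ^ (j ℕ.* j) *_) (∑-kernel N (j ℕ.+ j)) ⟩
    q ^ (j ℕ.* j) * (1/qq N * 1/qq (N ℕ.+ (j ℕ.+ j)))
      ≡⟨ cong₂ (λ u v → q ^ (j ℕ.* j) * (u * 1/qq v))
               (sym (trans (1/qqℤ-∸ (ℕP.m≤m+n j N)) (cong 1/qq (ℕP.m+n∸m≡n j N)))) (sym (reorder j N)) ⟩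
    q ^ (j ℕ.* j) * (1/qqℤ (+ (j ℕ.+ N) ℤ.- + j) * 1/qq (j ℕ.+ N ℕ.+ j)) ∎
    where
    open ≡-Reasoning
    t = baileyTerm (j ℕ.+ N) (+ j)
    zeroʳ : ∀ x y z → x * y * (0ℚ * z) ≡ 0ℚ
    zeroʳ = solve-∀ ℚ-ring
    low-terms : ∀ m → m < j → t m ≡ 0ℚ
    low-terms m m<j rewrite 1/qqℤ-< m<j = zeroʳ (q ^ (m ℕ.* m)) (1/qq (j ℕ.+ N ∸ m)) (1/qq (m ℕ.+ j))
    square : ∀ j i → (j ℕ.+ i) ℕ.* (j ℕ.+ i) ≡ j ℕ.* j ℕ.+ (i ℕ.* i ℕ.+ (j ℕ.+ j) ℕ.* i)
    square = ℕ-Solver.solve-∀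
    reorder : ∀ j i → j ℕ.+ i ℕ.+ j ≡ i ℕ.+ (j ℕ.+ j)
    reorder = ℕ-Solver.solve-∀
    regroup : ∀ A B C D E → A * B * C * (D * E) ≡ A * (B * C * D * E)
    regroup = solve-∀ ℚ-ring
    shift : ∀ i → t (j ℕ.+ i) ≡ q ^ (j ℕ.* j) * kernel N (j ℕ.+ j) i
    shift i = begin
      q ^ ((j ℕ.+ i) ℕ.* (j ℕ.+ i)) * 1/qq (j ℕ.+ N ∸ (j ℕ.+ i)) * (1/qqℤ (+ (j ℕ.+ i) ℤ.- + j) * 1/qq (j ℕ.+ i ℕ.+ j))
        ≡⟨ cong₂ (λ u v → q ^ ((j ℕ.+ i) ℕ.* (j ℕ.+ i)) * 1/qq u * (v * 1/qq (j ℕ.+ i ℕ.+ j)))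
                 (ℕP.[m+n]∸[m+o]≡n∸o j N i) (trans (1/qqℤ-∸ (ℕP.m≤m+n j i)) (cong 1/qq (ℕP.m+n∸m≡n j i))) ⟩
      q ^ ((j ℕ.+ i) ℕ.* (j ℕ.+ i)) * 1/qq (N ∸ i) * (1/qq i * 1/qq (j ℕ.+ i ℕ.+ j))
        ≡⟨ cong₂ (λ u v → u * 1/qq (N ∸ i) * (1/qq i * 1/qq v))
                 (trans (cong (q ^_) (square j i)) (^-distribˡ-+-* q (j ℕ.* j) _)) (reorder j i) ⟩
      q ^ (j ℕ.* j) * q ^ (i ℕ.* i ℕ.+ (j ℕ.+ j) ℕ.* i) * 1/qq (N ∸ i) * (1/qq i * 1/qq (i ℕ.+ (j ℕ.+ j)))
        ≡⟨ regroup (q ^ (j ℕ.* j)) _ _ _ _ ⟩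
      q ^ (j ℕ.* j) * kernel N (j ℕ.+ j) i ∎

  bailey-sum : ∀ n j → ∑< (suc n) (baileyTerm n (+ j)) ≡ q ^ (j ℕ.* j) * (1/qqℤ (+ n ℤ.- + j) * 1/qq (n ℕ.+ j))
  bailey-sum n j with j ℕ.≤? n
  ... | yes j≤n = subst (λ n → ∑< (suc n) (baileyTerm n (+ j)) ≡ q ^ (j ℕ.* j) * (1/qqℤ (+ n ℤ.- + j) * 1/qq (n ℕ.+ j)))
                        (ℕP.m+[n∸m]≡n j≤n) (bailey-sum-+ j (n ∸ j))
  ... | no j≰n = trans (∑-zero (suc n) (λ m m≤n → vanishing m (ℕP.≤-<-trans (ℕP.≤-pred m≤n) n<j)))
                       (sym (trans (cong (λ z → q ^ (j ℕ.* j) * (z * 1/qq (n ℕ.+ j))) (1/qqℤ-< n<j))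
                                   (zeroʳ (q ^ (j ℕ.* j)) (1/qq (n ℕ.+ j)))))
    where
    n<j = ℕP.≰⇒> j≰n
    zeroʳ : ∀ x y → x * (0ℚ * y) ≡ 0ℚ
    zeroʳ = solve-∀ ℚ-ring
    vanishing : ∀ m → m < j → baileyTerm n (+ j) m ≡ 0ℚ
    vanishing m m<j rewrite 1/qqℤ-< m<j = zeroʳ (q ^ (m ℕ.* m) * 1/qq (n ∸ m)) (1/qq (m ℕ.+ j))

  bailey-sumℤ : ∀ n k → ∑< (suc n) (baileyTerm n k)
                        ≡ q ^ (ℤ.∣ k ∣ ℕ.* ℤ.∣ k ∣) * (1/qqℤ (+ n ℤ.- k) * 1/qqℤ (+ n ℤ.+ k))
  bailey-sumℤ n (+ j)    = bailey-sum n j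
  bailey-sumℤ n -[1+ j ] = begin
    ∑< (suc n) (baileyTerm n -[1+ j ])
      ≡⟨ ∑-cong (suc n) (λ m → cong (q ^ (m ℕ.* m) * 1/qq (n ∸ m) *_)
                                    (ℚP.*-comm (1/qqℤ (+ m ℤ.- -[1+ j ])) (1/qqℤ (+ m ℤ.+ -[1+ j ])))) ⟩
    ∑< (suc n) (baileyTerm n (+ suc j))
      ≡⟨ bailey-sum n (suc j) ⟩
    q ^ (suc j ℕ.* suc j) * (1/qqℤ (+ n ℤ.- + suc j) * 1/qq (n ℕ.+ suc j))
      ≡⟨ cong (q ^ (suc j ℕ.* suc j) *_) (ℚP.*-comm (1/qqℤ (+ n ℤ.- + suc j)) (1/qq (n ℕ.+ suc j))) ⟩
    q ^ (suc j ℕ.* suc j) * (1/qqℤ (+ n ℤ.- -[1+ j ]) * 1/qqℤ (+ n ℤ.+ -[1+ j ])) ∎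
    where open ≡-Reasoning

  coeff : ℕ → ℤ → ℚ
  coeff p r = ℚ._/_ (sgnpow r) 1 * q ^ℤ (pent r ℤ.+ + p ℤ.* (kk r ℤ.* kk r))

  summand : ℕ → ℕ → ℤ → ℚ
  summand n p r = coeff p r * (1/qqℤ (+ n ℤ.- kk r) * 1/qqℤ (+ n ℤ.+ kk r))

  coeff-suc : ∀ p r → coeff (suc p) r ≡ coeff p r * q ^ (ℤ.∣ kk r ∣ ℕ.* ℤ.∣ kk r ∣)
  coeff-suc p r = begin
    σ * q ^ℤ (pent r ℤ.+ + suc p ℤ.* (kk r ℤ.* kk r))   ≡⟨ cong (λ e → σ * q ^ℤ e) (exponent-nonneg (suc p) r) ⟨
    σ * q ^ (P ℕ.+ suc p ℕ.* K)                         ≡⟨ cong (λ e → σ * q ^ e) (reorder P p K) ⟩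
    σ * q ^ ((P ℕ.+ p ℕ.* K) ℕ.+ K)                     ≡⟨ cong (σ *_) (^-distribˡ-+-* q (P ℕ.+ p ℕ.* K) K) ⟩
    σ * (q ^ (P ℕ.+ p ℕ.* K) * q ^ K)                   ≡⟨ ℚP.*-assoc σ _ _ ⟨
    σ * q ^ (P ℕ.+ p ℕ.* K) * q ^ K                     ≡⟨ cong (λ e → σ * q ^ℤ e * q ^ K) (exponent-nonneg p r) ⟩
    coeff p r * q ^ K                                   ∎
    where
    open ≡-Reasoning
    σ = ℚ._/_ (sgnpow r) 1
    P = ℤ.∣ pent r ∣
    K = ℤ.∣ kk r ∣ ℕ.* ℤ.∣ kk r ∣
    reorder : ∀ P p K → P ℕ.+ suc p ℕ.* K ≡ (P ℕ.+ p ℕ.* K) ℕ.+ K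
    reorder = ℕ-Solver.solve-∀

  bailey-step-summand : ∀ n p r → ∑[ m < suc n ] (q ^ (m ℕ.* m) * 1/qq (n ∸ m) * summand m p r) ≡ summand n (suc p) r
  bailey-step-summand n p r = begin
    ∑[ m < suc n ] (q ^ (m ℕ.* m) * 1/qq (n ∸ m) * (c * X m))
      ≡⟨ ∑-cong (suc n) (λ m → pull (q ^ (m ℕ.* m)) (1/qq (n ∸ m)) c (X m)) ⟩
    ∑[ m < suc n ] (c * baileyTerm n (kk r) m)
      ≡⟨ *-distribˡ-∑ (suc n) c (baileyTerm n (kk r)) ⟨
    c * ∑< (suc n) (baileyTerm n (kk r))
      ≡⟨ cong (c *_) (bailey-sumℤ n (kk r)) ⟩
    c * (q ^ (ℤ.∣ kk r ∣ ℕ.* ℤ.∣ kk r ∣) * X n)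
      ≡⟨ ℚP.*-assoc c _ (X n) ⟨
    c * q ^ (ℤ.∣ kk r ∣ ℕ.* ℤ.∣ kk r ∣) * X n
      ≡⟨ cong (_* X n) (coeff-suc p r) ⟨
    summand n (suc p) r ∎
    where
    open ≡-Reasoning
    c = coeff p r
    X : ℕ → ℚ
    X m = 1/qqℤ (+ m ℤ.- kk r) * 1/qqℤ (+ m ℤ.+ kk r)
    pull : ∀ a b c x → a * b * (c * x) ≡ c * (a * b * x)
    pull = solve-∀ ℚ-ring

  bailey-step : ∀ n p M → symSum (summand n (suc p)) M ≡ ∑[ m < suc n ] (q ^ (m ℕ.* m) * 1/qq (n ∸ m) * symSum (summand m p) M)
  bailey-step n p M = begin
    symSum (summand n (suc p)) M
      ≡⟨ symSum-cong M (λ r → sym (bailey-step-summand n p r)) ⟩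
    symSum (λ r → ∑[ m < suc n ] (q ^ (m ℕ.* m) * 1/qq (n ∸ m) * summand m p r)) M
      ≡⟨ symSum-∑-comm (suc n) (λ m r → q ^ (m ℕ.* m) * 1/qq (n ∸ m) * summand m p r) M ⟩
    ∑[ m < suc n ] symSum (λ r → q ^ (m ℕ.* m) * 1/qq (n ∸ m) * summand m p r) M
      ≡⟨ ∑-cong (suc n) (λ m → sym (*-distribˡ-symSum (q ^ (m ℕ.* m) * 1/qq (n ∸ m)) (summand m p) M)) ⟩
    ∑[ m < suc n ] (q ^ (m ℕ.* m) * 1/qq (n ∸ m) * symSum (summand m p) M) ∎
    where open ≡-Reasoning

  qbinom-+ : ∀ a x → qbinom q (+ a) (+ x) ≡ qq q a * (1/qq x * 1/qqℤ (+ a ℤ.- + x))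
  qbinom-+ a x with x ℕ.≤? a
  ... | yes x≤a = begin
    qq q a * inv (qq q x * qq q ℤ.∣ + a ℤ.- + x ∣)   ≡⟨ cong (λ k → qq q a * inv (qq q x * qq q ℤ.∣ k ∣)) a-x≡ ⟩
    qq q a * inv (qq q x * qq q (a ∸ x))             ≡⟨ cong (qq q a *_) (inv-distrib-* (qq q x) (qq q (a ∸ x))) ⟩
    qq q a * (1/qq x * 1/qq (a ∸ x))                 ≡⟨ cong (λ z → qq q a * (1/qq x * z)) (1/qqℤ-∸ x≤a) ⟨
    qq q a * (1/qq x * 1/qqℤ (+ a ℤ.- + x))          ∎
    where
    open ≡-Reasoning
    a-x≡ : + a ℤ.- + x ≡ + (a ∸ x)
    a-x≡ = trans (ℤP.m-n≡m⊖n a x) (ℤP.⊖-≥ x≤a)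
  ... | no x≰a = sym (trans (cong (λ z → qq q a * (1/qq x * z)) (1/qqℤ-< (ℕP.≰⇒> x≰a))) (zeroʳ (qq q a) (1/qq x)))
    where
    zeroʳ : ∀ x y → x * (y * 0ℚ) ≡ 0ℚ
    zeroʳ = solve-∀ ℚ-ring

  qbinom≡ : ∀ a b c → b ℤ.+ c ≡ + a → qbinom q (+ a) b ≡ qq q a * (1/qqℤ b * 1/qqℤ c)
  qbinom≡ a -[1+ _ ] c _ = sym (zeroʳ (qq q a) (1/qqℤ c))
    where
    zeroʳ : ∀ x y → x * (0ℚ * y) ≡ 0ℚ
    zeroʳ = solve-∀ ℚ-ring
  qbinom≡ a (+ x) c x+c≡a = trans (qbinom-+ a x) (cong (λ z → qq q a * (1/qq x * 1/qqℤ z)) (sym c≡a-x))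
    where
    cancel : ∀ b c → c ≡ (b ℤ.+ c) ℤ.- b
    cancel = ℤ-Solver.solve-∀
    c≡a-x : c ≡ + a ℤ.- + x
    c≡a-x = trans (cancel (+ x) c) (cong (ℤ._- + x) x+c≡a)

  rhsTerm≡ : ∀ n p r → rhsTerm q n p r ≡ qq q (2 ℕ.* n) * summand n p r
  rhsTerm≡ n p r = trans (cong (coeff p r *_) (qbinom≡ (2 ℕ.* n) (+ n ℤ.- kk r) (+ n ℤ.+ kk r) sum≡))
                         (swap (coeff p r) (qq q (2 ℕ.* n)) (1/qqℤ (+ n ℤ.- kk r) * 1/qqℤ (+ n ℤ.+ kk r)))
    where
    swap : ∀ a b c → a * (b * c) ≡ b * (a * c)
    swap = solve-∀ ℚ-ring
    twice : ∀ x k → (x ℤ.- k) ℤ.+ (x ℤ.+ k) ≡ + 2 ℤ.* x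
    twice = ℤ-Solver.solve-∀
    sum≡ : (+ n ℤ.- kk r) ℤ.+ (+ n ℤ.+ kk r) ≡ + (2 ℕ.* n)
    sum≡ = trans (twice (+ n) (kk r)) (sym (ℤP.pos-* 2 n))

  chainSum : ℕ → ℕ → ℚ
  chainSum p u = Σℚ (map (λ v → q ^ sqsum v * inv (denom q u v)) (chains p u))

  lhs≡ : ∀ n p → lhs q n p ≡ qq q (2 ℕ.* n) * chainSum p n
  lhs≡ n p = trans (Σℚ-map-cong (chains p n) (λ v → swap (q ^ sqsum v) (qq q (2 ℕ.* n)) (inv (denom q n v))))
                   (sym (*-distribˡ-Σℚ (qq q (2 ℕ.* n)) (λ v → q ^ sqsum v * inv (denom q n v)) (chains p n)))
    where
    swap : ∀ a c d → a * c * d ≡ c * (a * d)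
    swap = solve-∀ ℚ-ring

  chainSum-zero : ∀ u → chainSum 0 u ≡ 1/qq (2 ℕ.* u)
  chainSum-zero u = unit (1/qq (2 ℕ.* u))
    where
    unit : ∀ x → 1ℚ * x + 0ℚ ≡ x
    unit = solve-∀ ℚ-ring

  chainSum-suc : ∀ p u → chainSum (suc p) u ≡ ∑[ m < suc u ] (q ^ (m ℕ.* m) * 1/qq (u ∸ m) * chainSum p m)
  chainSum-suc p u = begin
    Σℚ (map f (concatMap (λ m → map (m ∷_) (chains p m)) (upTo (suc u))))
      ≡⟨ Σℚ-concatMap f (λ m → map (m ∷_) (chains p m)) (upTo (suc u)) ⟩
    Σℚ (map (λ m → Σℚ (map f (map (m ∷_) (chains p m)))) (upTo (suc u)))
      ≡⟨ Σℚ-map-cong (upTo (suc u)) first-part ⟩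
    Σℚ (map (λ m → q ^ (m ℕ.* m) * 1/qq (u ∸ m) * chainSum p m) (upTo (suc u)))
      ≡⟨ Σℚ-upTo _ (suc u) ⟩
    ∑[ m < suc u ] (q ^ (m ℕ.* m) * 1/qq (u ∸ m) * chainSum p m) ∎
    where
    open ≡-Reasoning
    f : Vec ℕ (suc p) → ℚ
    f v = q ^ sqsum v * inv (denom q u v)
    regroup : ∀ a b c d → a * b * (c * d) ≡ a * c * (b * d)
    regroup = solve-∀ ℚ-ring
    peel : ∀ m v → f (m ∷ v) ≡ q ^ (m ℕ.* m) * 1/qq (u ∸ m) * (q ^ sqsum v * inv (denom q m v))
    peel m v = trans (cong₂ _*_ (^-distribˡ-+-* q (m ℕ.* m) (sqsum v)) (inv-distrib-* (qq q (u ∸ m)) (denom q m v)))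
                     (regroup (q ^ (m ℕ.* m)) (q ^ sqsum v) (1/qq (u ∸ m)) (inv (denom q m v)))
    first-part : ∀ m → Σℚ (map f (map (m ∷_) (chains p m))) ≡ q ^ (m ℕ.* m) * 1/qq (u ∸ m) * chainSum p m
    first-part m = begin
      Σℚ (map f (map (m ∷_) (chains p m)))      ≡⟨ cong Σℚ (ListP.map-∘ (chains p m)) ⟨
      Σℚ (map (f ∘ (m ∷_)) (chains p m))        ≡⟨ Σℚ-map-cong (chains p m) (peel m) ⟩
      Σℚ (map (λ v → q ^ (m ℕ.* m) * 1/qq (u ∸ m) * (q ^ sqsum v * inv (denom q m v))) (chains p m))
        ≡⟨ *-distribˡ-Σℚ (q ^ (m ℕ.* m) * 1/qq (u ∸ m)) (λ v → q ^ sqsum v * inv (denom q m v)) (chains p m) ⟨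
      q ^ (m ℕ.* m) * 1/qq (u ∸ m) * chainSum p m ∎

  -- E N s is the pair of summands r = 2s, 2s + 1 (where kk r = 3s, 3s + 2) at n = N. The q-Pascal rule leads
  -- from E N to the intermediate family O N, and from O N to E (N + 1) up to the telescoping terms H.
  E O H : ℤ → ℤ → ℚ
  E N s = q ^ pentEven s * (1/qqℤ (N ℤ.- + 3 ℤ.* s) * 1/qqℤ (N ℤ.+ + 3 ℤ.* s))
        - q ^ pentOdd s * (1/qqℤ (N ℤ.- (+ 3 ℤ.* s ℤ.+ + 2)) * 1/qqℤ (N ℤ.+ (+ 3 ℤ.* s ℤ.+ + 2)))
  O N s = q ^ pentEven s * (1/qqℤ (N ℤ.- + 3 ℤ.* s) * 1/qqℤ (N ℤ.+ (+ 3 ℤ.* s ℤ.+ 1ℤ)))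
        - q ^ pentOdd s * (1/qqℤ (N ℤ.- (+ 3 ℤ.* s ℤ.+ 1ℤ)) * 1/qqℤ (N ℤ.+ (+ 3 ℤ.* s ℤ.+ + 2)))
  H N s = q ^ pentOdd s * (q ^ℤ (N ℤ.+ (+ 3 ℤ.* s ℤ.+ + 3))
        * (1/qqℤ (N ℤ.- (+ 3 ℤ.* s ℤ.+ + 2)) * 1/qqℤ (N ℤ.+ (+ 3 ℤ.* s ℤ.+ + 3))))

  O-step : ∀ N s → (1ℚ - q ^ℤ (N ℤ.+ N ℤ.+ 1ℤ)) * O N s ≡ E N s
  O-step N s = begin
    (1ℚ - q ^ℤ (N ℤ.+ N ℤ.+ 1ℤ)) * O N s
      ≡⟨ difference-step (1ℚ - q ^ℤ (N ℤ.+ N ℤ.+ 1ℤ)) A B X₁ X₂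
           (pascalʳ-at (N ℤ.- t) (N ℤ.+ (t ℤ.+ 1ℤ)) (i₁ N t) refl refl (i₂ N t) (i₃ N t))
           (pascalˡ-at (N ℤ.- (t ℤ.+ 1ℤ)) (N ℤ.+ (t ℤ.+ + 2)) (i₄ N t) refl refl (i₅ N t) (i₆ N t)) ⟩
    E N s + (A * R - B * R′)
      ≡⟨ cong (λ z → E N s + (A * R - z)) (^ℤ-shift (pentOdd s) (pentEven s) x y exponents) ⟩
    E N s + (A * R - A * R)
      ≡⟨ cancel (E N s) (A * R) ⟩
    E N s ∎
    where
    open ≡-Reasoning
    t = + 3 ℤ.* s
    x = N ℤ.- (t ℤ.+ 1ℤ)
    y = N ℤ.+ (t ℤ.+ 1ℤ)
    A = q ^ pentEven s
    B = q ^ pentOdd s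
    X₁ = 1/qqℤ (N ℤ.- t) * 1/qqℤ (N ℤ.+ (t ℤ.+ 1ℤ))
    X₂ = 1/qqℤ x * 1/qqℤ (N ℤ.+ (t ℤ.+ + 2))
    R = q ^ℤ y * (1/qqℤ x * 1/qqℤ y)
    R′ = q ^ℤ x * (1/qqℤ x * 1/qqℤ y)
    cancel : ∀ a b → a + (b - b) ≡ a
    cancel = solve-∀ ℚ-ring
    i₁ : ∀ N t → (N ℤ.- t) ℤ.+ (N ℤ.+ (t ℤ.+ 1ℤ)) ≡ N ℤ.+ N ℤ.+ 1ℤ
    i₁ = ℤ-Solver.solve-∀
    i₂ : ∀ N t → (N ℤ.- t) ℤ.- 1ℤ ≡ N ℤ.- (t ℤ.+ 1ℤ)
    i₂ = ℤ-Solver.solve-∀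
    i₃ : ∀ N t → (N ℤ.+ (t ℤ.+ 1ℤ)) ℤ.- 1ℤ ≡ N ℤ.+ t
    i₃ = ℤ-Solver.solve-∀
    i₄ : ∀ N t → (N ℤ.- (t ℤ.+ 1ℤ)) ℤ.+ (N ℤ.+ (t ℤ.+ + 2)) ≡ N ℤ.+ N ℤ.+ 1ℤ
    i₄ = ℤ-Solver.solve-∀
    i₅ : ∀ N t → (N ℤ.- (t ℤ.+ 1ℤ)) ℤ.- 1ℤ ≡ N ℤ.- (t ℤ.+ + 2)
    i₅ = ℤ-Solver.solve-∀
    i₆ : ∀ N t → (N ℤ.+ (t ℤ.+ + 2)) ℤ.- 1ℤ ≡ N ℤ.+ (t ℤ.+ 1ℤ)
    i₆ = ℤ-Solver.solve-∀
    exponents : + pentOdd s ℤ.+ x ≡ + pentEven s ℤ.+ y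
    exponents rewrite +pentOdd s | +pentEven s = match N s
      where
      match : ∀ N s → (+ 2 ℤ.* s ℤ.+ 1ℤ) ℤ.* (+ 3 ℤ.* s ℤ.+ + 2) ℤ.+ (N ℤ.- (+ 3 ℤ.* s ℤ.+ 1ℤ))
                      ≡ s ℤ.* (+ 6 ℤ.* s ℤ.+ 1ℤ) ℤ.+ (N ℤ.+ (+ 3 ℤ.* s ℤ.+ 1ℤ))
      match = ℤ-Solver.solve-∀

  E-step : ∀ N s → (1ℚ - q ^ℤ (N ℤ.+ N ℤ.+ + 2)) * E (N ℤ.+ 1ℤ) s ≡ O N s + (H N (s ℤ.- 1ℤ) - H N s)
  E-step N s = begin
    (1ℚ - q ^ℤ (N ℤ.+ N ℤ.+ + 2)) * E (N ℤ.+ 1ℤ) s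
      ≡⟨ difference-step (1ℚ - q ^ℤ (N ℤ.+ N ℤ.+ + 2)) A (q ^ pentOdd s) X₁ X₂
           (pascalˡ-at (N′ ℤ.- t) (N′ ℤ.+ t) (i₁ N t) refl (i₂ N t) (i₃ N t) (i₄ N t))
           (pascalʳ-at (N′ ℤ.- (t ℤ.+ + 2)) (N′ ℤ.+ (t ℤ.+ + 2)) (i₅ N t) (i₆ N t) (i₇ N t) (i₈ N t) (i₉ N t)) ⟩
    O N s + (A * (q ^ℤ u * (1/qqℤ u * 1/qqℤ v)) - H N s)
      ≡⟨ cong (λ z → O N s + (z - H N s)) (^ℤ-shift (pentEven s) (pentOdd (s ℤ.- 1ℤ)) u v exponents) ⟩
    O N s + (q ^ pentOdd (s ℤ.- 1ℤ) * (q ^ℤ v * (1/qqℤ u * 1/qqℤ v)) - H N s)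
      ≡⟨ cong₂ (λ u′ v′ → O N s + (q ^ pentOdd (s ℤ.- 1ℤ) * (q ^ℤ v′ * (1/qqℤ u′ * 1/qqℤ v′)) - H N s))
               (i₁₀ N s) (i₁₁ N s) ⟩
    O N s + (H N (s ℤ.- 1ℤ) - H N s) ∎
    where
    open ≡-Reasoning
    t = + 3 ℤ.* s
    N′ = N ℤ.+ 1ℤ
    u = N′ ℤ.- t
    v = N ℤ.+ t
    A = q ^ pentEven s
    X₁ = 1/qqℤ (N′ ℤ.- t) * 1/qqℤ (N′ ℤ.+ t)
    X₂ = 1/qqℤ (N′ ℤ.- (t ℤ.+ + 2)) * 1/qqℤ (N′ ℤ.+ (t ℤ.+ + 2))
    i₁ : ∀ N t → (N ℤ.+ 1ℤ ℤ.- t) ℤ.+ (N ℤ.+ 1ℤ ℤ.+ t) ≡ N ℤ.+ N ℤ.+ + 2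
    i₁ = ℤ-Solver.solve-∀
    i₂ : ∀ N t → N ℤ.+ 1ℤ ℤ.+ t ≡ N ℤ.+ (t ℤ.+ 1ℤ)
    i₂ = ℤ-Solver.solve-∀
    i₃ : ∀ N t → (N ℤ.+ 1ℤ ℤ.- t) ℤ.- 1ℤ ≡ N ℤ.- t
    i₃ = ℤ-Solver.solve-∀
    i₄ : ∀ N t → (N ℤ.+ 1ℤ ℤ.+ t) ℤ.- 1ℤ ≡ N ℤ.+ t
    i₄ = ℤ-Solver.solve-∀
    i₅ : ∀ N t → (N ℤ.+ 1ℤ ℤ.- (t ℤ.+ + 2)) ℤ.+ (N ℤ.+ 1ℤ ℤ.+ (t ℤ.+ + 2)) ≡ N ℤ.+ N ℤ.+ + 2
    i₅ = ℤ-Solver.solve-∀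
    i₆ : ∀ N t → N ℤ.+ 1ℤ ℤ.- (t ℤ.+ + 2) ≡ N ℤ.- (t ℤ.+ 1ℤ)
    i₆ = ℤ-Solver.solve-∀
    i₇ : ∀ N t → N ℤ.+ 1ℤ ℤ.+ (t ℤ.+ + 2) ≡ N ℤ.+ (t ℤ.+ + 3)
    i₇ = ℤ-Solver.solve-∀
    i₈ : ∀ N t → (N ℤ.+ 1ℤ ℤ.- (t ℤ.+ + 2)) ℤ.- 1ℤ ≡ N ℤ.- (t ℤ.+ + 2)
    i₈ = ℤ-Solver.solve-∀
    i₉ : ∀ N t → (N ℤ.+ 1ℤ ℤ.+ (t ℤ.+ + 2)) ℤ.- 1ℤ ≡ N ℤ.+ (t ℤ.+ + 2)
    i₉ = ℤ-Solver.solve-∀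
    i₁₀ : ∀ N s → N ℤ.+ 1ℤ ℤ.- + 3 ℤ.* s ≡ N ℤ.- (+ 3 ℤ.* (s ℤ.- 1ℤ) ℤ.+ + 2)
    i₁₀ = ℤ-Solver.solve-∀
    i₁₁ : ∀ N s → N ℤ.+ + 3 ℤ.* s ≡ N ℤ.+ (+ 3 ℤ.* (s ℤ.- 1ℤ) ℤ.+ + 3)
    i₁₁ = ℤ-Solver.solve-∀
    exponents : + pentEven s ℤ.+ u ≡ + pentOdd (s ℤ.- 1ℤ) ℤ.+ v
    exponents rewrite +pentEven s | +pentOdd (s ℤ.- 1ℤ) = match N s
      where
      match : ∀ N s → s ℤ.* (+ 6 ℤ.* s ℤ.+ 1ℤ) ℤ.+ (N ℤ.+ 1ℤ ℤ.- + 3 ℤ.* s)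
                      ≡ (+ 2 ℤ.* (s ℤ.- 1ℤ) ℤ.+ 1ℤ) ℤ.* (+ 3 ℤ.* (s ℤ.- 1ℤ) ℤ.+ + 2) ℤ.+ (N ℤ.+ + 3 ℤ.* s)
      match = ℤ-Solver.solve-∀

  E-zero-pos : ∀ i → E (+ 0) (+ suc i) ≡ 0ℚ
  E-zero-pos i = vanishes (q ^ pentEven (+ suc i)) (q ^ pentOdd (+ suc i))
                         (1/qqℤ (+ 0 ℤ.+ + 3 ℤ.* + suc i)) (1/qqℤ (+ 0 ℤ.+ (+ 3 ℤ.* + suc i ℤ.+ + 2)))
    where
    vanishes : ∀ a b x y → a * (0ℚ * x) - b * (0ℚ * y) ≡ 0ℚ
    vanishes = solve-∀ ℚ-ring

  E-zero-neg : ∀ i → E (+ 0) -[1+ i ] ≡ 0ℚ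
  E-zero-neg i = trans (cong (λ z → A * (X * 0ℚ) - B * (Y * z)) [3s+2]≡0) (vanishes A B X Y)
    where
    A = q ^ pentEven -[1+ i ]
    B = q ^ pentOdd -[1+ i ]
    X = 1/qqℤ (+ 0 ℤ.- + 3 ℤ.* -[1+ i ])
    Y = 1/qqℤ (+ 0 ℤ.- (+ 3 ℤ.* -[1+ i ] ℤ.+ + 2))
    vanishes : ∀ a b x y → a * (x * 0ℚ) - b * (y * 0ℚ) ≡ 0ℚ
    vanishes = solve-∀ ℚ-ring
    index : ∀ x → + 0 ℤ.+ (+ 3 ℤ.* ℤ.- (1ℤ ℤ.+ x) ℤ.+ + 2) ≡ ℤ.- (1ℤ ℤ.+ + 3 ℤ.* x)
    index = ℤ-Solver.solve-∀
    [3s+2]≡0 : 1/qqℤ (+ 0 ℤ.+ (+ 3 ℤ.* -[1+ i ] ℤ.+ + 2)) ≡ 0ℚ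
    [3s+2]≡0 = cong 1/qqℤ (trans (index (+ i)) (cong (λ w → ℤ.- (1ℤ ℤ.+ w)) (sym (ℤP.pos-* 3 i))))

  ∑E-zero : ∀ L → symSum (E (+ 0)) L ≡ 1ℚ
  ∑E-zero zero    = centre (q ^ 2) (1/qq 2)
    where
    centre : ∀ b y → 1ℚ * (1ℚ * 1ℚ) - b * (0ℚ * y) ≡ 1ℚ
    centre = solve-∀ ℚ-ring
  ∑E-zero (suc L) = cong₂ _+_ (cong₂ _+_ (∑E-zero L) (E-zero-pos L)) (E-zero-neg L)

  H-vanishes-+ : ∀ {n} L → n < 3 ℕ.* L ℕ.+ 2 → H (+ n) (+ L) ≡ 0ℚ
  H-vanishes-+ {n} L n<3L+2 = trans (cong (λ z → B * (W * (z * Y))) [n-3L-2]≡0) (vanishes B W Y)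
    where
    B = q ^ pentOdd (+ L)
    W = q ^ℤ (+ n ℤ.+ (+ 3 ℤ.* + L ℤ.+ + 3))
    Y = 1/qqℤ (+ n ℤ.+ (+ 3 ℤ.* + L ℤ.+ + 3))
    vanishes : ∀ b w y → b * (w * (0ℚ * y)) ≡ 0ℚ
    vanishes = solve-∀ ℚ-ring
    [n-3L-2]≡0 : 1/qqℤ (+ n ℤ.- (+ 3 ℤ.* + L ℤ.+ + 2)) ≡ 0ℚ
    [n-3L-2]≡0 = trans (cong (λ z → 1/qqℤ (+ n ℤ.- z)) (sym (pos-affine 3 L 2))) (1/qqℤ-< n<3L+2)

  H-vanishes-- : ∀ {n} L → n < 3 ℕ.* L → H (+ n) -[1+ L ] ≡ 0ℚ
  H-vanishes-- {n} L n<3L = trans (cong (λ z → B * (W * (X * z))) [n-3L]≡0) (vanishes B W X)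
    where
    s = -[1+ L ]
    B = q ^ pentOdd s
    W = q ^ℤ (+ n ℤ.+ (+ 3 ℤ.* s ℤ.+ + 3))
    X = 1/qqℤ (+ n ℤ.- (+ 3 ℤ.* s ℤ.+ + 2))
    vanishes : ∀ b w x → b * (w * (x * 0ℚ)) ≡ 0ℚ
    vanishes = solve-∀ ℚ-ring
    index : ∀ N x → N ℤ.+ (+ 3 ℤ.* ℤ.- (1ℤ ℤ.+ x) ℤ.+ + 3) ≡ N ℤ.- + 3 ℤ.* x
    index = ℤ-Solver.solve-∀
    [n-3L]≡0 : 1/qqℤ (+ n ℤ.+ (+ 3 ℤ.* s ℤ.+ + 3)) ≡ 0ℚ
    [n-3L]≡0 = trans (cong 1/qqℤ (trans (index (+ n) (+ L)) (cong (λ w → + n ℤ.- w) (sym (ℤP.pos-* 3 L)))))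
                     (1/qqℤ-< n<3L)

  q^[2n+1] : ∀ n → q ^ℤ (+ n ℤ.+ + n ℤ.+ 1ℤ) ≡ q ^ suc (2 ℕ.* n)
  q^[2n+1] n = cong (q ^_) (twice n)
    where
    twice : ∀ n → n ℕ.+ n ℕ.+ 1 ≡ suc (2 ℕ.* n)
    twice = ℕ-Solver.solve-∀

  q^[2n+2] : ∀ n → q ^ℤ (+ n ℤ.+ + n ℤ.+ + 2) ≡ q ^ suc (suc (2 ℕ.* n))
  q^[2n+2] n = cong (q ^_) (twice n)
    where
    twice : ∀ n → n ℕ.+ n ℕ.+ 2 ≡ suc (suc (2 ℕ.* n))
    twice = ℕ-Solver.solve-∀

  ∑E : ∀ n L → n ≤ L → symSum (E (+ n)) L ≡ 1/qq (2 ℕ.* n)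
  ∑O : ∀ n L → n < L → symSum (O (+ n)) L ≡ 1/qq (suc (2 ℕ.* n))

  ∑E zero    L _   = ∑E-zero L
  ∑E (suc n) L n<L = *-cancelˡ-≢0 _ _ (1-q^suc≢0 (suc (2 ℕ.* n))) (begin
    c * symSum (E (+ suc n)) L
      ≡⟨ *-distribˡ-symSum c (E (+ suc n)) L ⟩
    symSum (λ s → c * E (+ suc n) s) L
      ≡⟨ symSum-cong L step ⟩
    symSum (λ s → O (+ n) s + (H (+ n) (s ℤ.- 1ℤ) - H (+ n) s)) L
      ≡⟨ symSum-distrib-+ (O (+ n)) (λ s → H (+ n) (s ℤ.- 1ℤ) - H (+ n) s) L ⟩
    symSum (O (+ n)) L + symSum (λ s → H (+ n) (s ℤ.- 1ℤ) - H (+ n) s) L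
      ≡⟨ cong₂ _+_ (∑O n L n<L) (symSum-telescope (H (+ n)) L) ⟩
    1/qq (suc (2 ℕ.* n)) + (H (+ n) -[1+ L ] - H (+ n) (+ L))
      ≡⟨ cong₂ (λ a b → 1/qq (suc (2 ℕ.* n)) + (a - b)) (H-vanishes-- L n<3L) (H-vanishes-+ L n<3L+2) ⟩
    1/qq (suc (2 ℕ.* n)) + (0ℚ - 0ℚ)
      ≡⟨ ℚP.+-identityʳ (1/qq (suc (2 ℕ.* n))) ⟩
    1/qq (suc (2 ℕ.* n))
      ≡⟨ 1/qq-suc (suc (2 ℕ.* n)) ⟨
    c * 1/qq (suc (suc (2 ℕ.* n)))
      ≡⟨ cong (λ k → c * 1/qq k) (ℕP.*-suc 2 n) ⟨
    c * 1/qq (2 ℕ.* suc n) ∎)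
    where
    open ≡-Reasoning
    c = 1ℚ - q ^ suc (suc (2 ℕ.* n))
    n<3L : n < 3 ℕ.* L
    n<3L = ℕP.<-≤-trans n<L (ℕP.m≤n*m L 3)
    n<3L+2 : n < 3 ℕ.* L ℕ.+ 2
    n<3L+2 = ℕP.<-≤-trans n<3L (ℕP.m≤m+n (3 ℕ.* L) 2)
    step : ∀ s → c * E (+ suc n) s ≡ O (+ n) s + (H (+ n) (s ℤ.- 1ℤ) - H (+ n) s)
    step s = trans (cong₂ (λ e N → (1ℚ - e) * E N s) (sym (q^[2n+2] n)) (cong +_ (ℕP.+-comm 1 n))) (E-step (+ n) s)

  ∑O n L n<L = *-cancelˡ-≢0 _ _ (1-q^suc≢0 (2 ℕ.* n)) (begin
    c * symSum (O (+ n)) L                 ≡⟨ *-distribˡ-symSum c (O (+ n)) L ⟩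
    symSum (λ s → c * O (+ n) s) L         ≡⟨ symSum-cong L step ⟩
    symSum (E (+ n)) L                     ≡⟨ ∑E n L (ℕP.<⇒≤ n<L) ⟩
    1/qq (2 ℕ.* n)                         ≡⟨ 1/qq-suc (2 ℕ.* n) ⟨
    c * 1/qq (suc (2 ℕ.* n))               ∎)
    where
    open ≡-Reasoning
    c = 1ℚ - q ^ suc (2 ℕ.* n)
    step : ∀ s → c * O (+ n) s ≡ E (+ n) s
    step s = trans (cong (λ e → (1ℚ - e) * O (+ n) s) (sym (q^[2n+1] n))) (O-step (+ n) s)

  summand-zero : ∀ m r {e k σ} → pent r ≡ + e → kk r ≡ k → sgnpow r ≡ σ →
                 summand m 0 r ≡ ℚ._/_ σ 1 * q ^ e * (1/qqℤ (+ m ℤ.- k) * 1/qqℤ (+ m ℤ.+ k))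
  summand-zero m r {e} pent≡ refl refl rewrite pent≡ =
    cong (λ d → ℚ._/_ (sgnpow r) 1 * q ^ d * (1/qqℤ (+ m ℤ.- kk r) * 1/qqℤ (+ m ℤ.+ kk r))) (ℕP.+-identityʳ e)

  summand-pair : ∀ m s → summand m 0 (+ 2 ℤ.* s) + summand m 0 (+ 2 ℤ.* s ℤ.+ 1ℤ) ≡ E (+ m) s
  summand-pair m s = trans (cong₂ _+_ (summand-zero m (+ 2 ℤ.* s) (pent-even s) (kk-even s) (sgnpow-even s))
                                      (summand-zero m (+ 2 ℤ.* s ℤ.+ 1ℤ) (pent-odd s) (kk-odd s) (sgnpow-odd s)))
                           (signs (q ^ pentEven s) (q ^ pentOdd s) _ _)
    where
    signs : ∀ a b x y → 1ℚ * a * x + (- 1ℚ) * b * y ≡ a * x - b * y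
    signs = solve-∀ ℚ-ring

  summand-vanishes : ∀ {m} p r → m < ℤ.∣ kk r ∣ → summand m p r ≡ 0ℚ
  summand-vanishes {m} p r m<∣k∣ = trans (cong (coeff p r *_) (product-vanishes (kk r) m<∣k∣)) (ℚP.*-zeroʳ (coeff p r))
    where
    product-vanishes : ∀ k → m < ℤ.∣ k ∣ → 1/qqℤ (+ m ℤ.- k) * 1/qqℤ (+ m ℤ.+ k) ≡ 0ℚ
    product-vanishes (+ k)    m<k = trans (cong (_* 1/qq (m ℕ.+ k)) (1/qqℤ-< m<k)) (ℚP.*-zeroˡ (1/qq (m ℕ.+ k)))
    product-vanishes -[1+ k ] m<k = trans (cong (1/qqℤ (+ m ℤ.- -[1+ k ]) *_) (1/qqℤ-< m<k)) (ℚP.*-zeroʳ (1/qqℤ (+ m ℤ.- -[1+ k ])))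

  pentagonal-even : ∀ m L → m ≤ L → symSum (summand m 0) (2 ℕ.* L) ≡ 1/qq (2 ℕ.* m)
  pentagonal-even m L m≤L = begin
    symSum f (2 ℕ.* L)
      ≡⟨ ℚP.+-identityʳ (symSum f (2 ℕ.* L)) ⟨
    symSum f (2 ℕ.* L) + 0ℚ
      ≡⟨ cong (_+_ (symSum f (2 ℕ.* L))) (summand-vanishes 0 (+ suc (2 ℕ.* L)) m<∣k∣) ⟨
    symSum f (2 ℕ.* L) + f (+ suc (2 ℕ.* L))
      ≡⟨ symSum-pairs f L ⟩
    symSum (λ s → f (+ 2 ℤ.* s) + f (+ 2 ℤ.* s ℤ.+ 1ℤ)) L
      ≡⟨ symSum-cong L (summand-pair m) ⟩
    symSum (E (+ m)) L
      ≡⟨ ∑E m L m≤L ⟩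
    1/qq (2 ℕ.* m) ∎
    where
    open ≡-Reasoning
    f = summand m 0
    m<∣k∣ : m < ℤ.∣ kk (+ suc (2 ℕ.* L)) ∣
    m<∣k∣ = subst (m <_) (sym (∣kk[2L+1]∣ L))
                  (ℕP.≤-<-trans (ℕP.≤-trans m≤L (ℕP.m≤n*m L 3)) (ℕP.m<m+n (3 ℕ.* L) (s≤s z≤n)))

  pentagonal-odd : ∀ m L → m ≤ L → symSum (summand m 0) (suc (2 ℕ.* L)) ≡ 1/qq (2 ℕ.* m)
  pentagonal-odd m L m≤L = begin
    symSum f (2 ℕ.* L) + f (+ suc (2 ℕ.* L)) + f -[1+ 2 ℕ.* L ]
      ≡⟨ cong₂ _+_ (symSum-pairs f L) (summand-vanishes 0 -[1+ 2 ℕ.* L ] m<∣k∣) ⟩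
    symSum (λ s → f (+ 2 ℤ.* s) + f (+ 2 ℤ.* s ℤ.+ 1ℤ)) L + 0ℚ
      ≡⟨ ℚP.+-identityʳ _ ⟩
    symSum (λ s → f (+ 2 ℤ.* s) + f (+ 2 ℤ.* s ℤ.+ 1ℤ)) L
      ≡⟨ symSum-cong L (summand-pair m) ⟩
    symSum (E (+ m)) L
      ≡⟨ ∑E m L m≤L ⟩
    1/qq (2 ℕ.* m) ∎
    where
    open ≡-Reasoning
    f = summand m 0
    m<∣k∣ : m < ℤ.∣ kk -[1+ 2 ℕ.* L ] ∣
    m<∣k∣ = subst (m <_) (sym (∣kk[-2L-1]∣ L)) (s≤s (ℕP.≤-trans m≤L (ℕP.m≤n*m L 3)))

  -- Multiplied by (q;q)_{2m}: Σ_r (-1)^r q^(r(3r+1)/2) [2m choose m - kk r] = 1, a finite form of Euler's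
  -- pentagonal number theorem.
  pentagonal : ∀ m M → suc (2 ℕ.* m) ≤ M → symSum (summand m 0) M ≡ 1/qq (2 ℕ.* m)
  pentagonal m M 2m<M with even-or-odd M
  ... | L , inj₁ refl = pentagonal-even m L (ℕP.*-cancelˡ-≤ 2 (ℕP.<⇒≤ 2m<M))
  ... | L , inj₂ refl = pentagonal-odd m L (ℕP.*-cancelˡ-≤ 2 (ℕP.≤-pred 2m<M))

  symSum-summand : ∀ p m M → suc (2 ℕ.* m) ≤ M → symSum (summand m p) M ≡ chainSum p m
  symSum-summand zero    m M 2m<M = trans (pentagonal m M 2m<M) (sym (chainSum-zero m))
  symSum-summand (suc p) m M 2m<M = begin
    symSum (summand m (suc p)) M
      ≡⟨ bailey-step m p M ⟩
    ∑[ j < suc m ] (q ^ (j ℕ.* j) * 1/qq (m ∸ j) * symSum (summand j p) M)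
      ≡⟨ ∑-cong-< (suc m) (λ j j≤m → cong (q ^ (j ℕ.* j) * 1/qq (m ∸ j) *_) (symSum-summand p j M (2j<M j j≤m))) ⟩
    ∑[ j < suc m ] (q ^ (j ℕ.* j) * 1/qq (m ∸ j) * chainSum p j)
      ≡⟨ chainSum-suc p m ⟨
    chainSum (suc p) m ∎
    where
    open ≡-Reasoning
    2j<M : ∀ j → j < suc m → suc (2 ℕ.* j) ≤ M
    2j<M j j≤m = ℕP.≤-trans (s≤s (ℕP.*-monoʳ-≤ 2 (ℕP.≤-pred j≤m))) 2m<M

theorem1p8 : (q : ℚ) → q ≢ 1ℚ → q ≢ - 1ℚ → (n p : ℕ) → 1 ≤ p →
    ∃ λ N → (M : ℕ) → N ≤ M → symSum (rhsTerm q n p) M ≡ lhs q n p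
theorem1p8 q q≢1 q≢-1 n p _ = suc (2 ℕ.* n) , λ M 2n<M → begin
  symSum (rhsTerm q n p) M                     ≡⟨ symSum-cong M (rhsTerm≡ n p) ⟩
  symSum (λ r → qq q (2 ℕ.* n) * summand n p r) M ≡⟨ *-distribˡ-symSum (qq q (2 ℕ.* n)) (summand n p) M ⟨
  qq q (2 ℕ.* n) * symSum (summand n p) M      ≡⟨ cong (qq q (2 ℕ.* n) *_) (symSum-summand p n M 2n<M) ⟩
  qq q (2 ℕ.* n) * chainSum p n                ≡⟨ lhs≡ n p ⟨
  lhs q n p                                    ∎
  where
  open ≡-Reasoning
  open QSeries q (^-suc≢1 q≢1 q≢-1)
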